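{- Let $G$ be a $B_2$-EPG graph with a fixed $B_2$-EPG representation, let $a,b$ be two rows and let $Y$ be a set of vertices each having index exactly $\{a,b\}$. Suppose that the projection graph of $Y$ on $a$ is not a clique. Then there is a proper typed interval $t$ on row $a$ such that: (1) every vertex of $Y$ intersects $t$; (2) if $u$ is a vertex with index $\{a\}$ or with index $\{a,c\}$ where $c\neq a,b$, then $u$ is adjacent to every vertex of $Y$ if and only if $u$ contains $t$.
   Context: An EPG representation of a graph $G$ assigns to every vertex $u$ a path $P_u$ in the rectangular grid, such that distinct $u,v$ are adjacent iff $P_u,P_v$ share a grid edge; a bend is a point where a path turns between horizontal and vertical; $G$ is $B_2$-EPG if some representation has every path with at most $2$ bends. Rows are horizontal grid lines, columns vertical ones; the point of row $a$ at column $\alpha$ is denoted $\alpha$. A vertex $u$ intersects a row if $P_u$ contains a grid edge of it; the index of $u$ is the set of rows it intersects. If $a$ is in the index of $u$, the extremities of $u$ on $a$ are the (exactly two) points of row $a$ at which $P_u$ stops or bends, and $P_u^a=[\alpha,\beta]$ is the segment of row $a$ between them. Types: $\emptyset$, $\downarrow$, $\uparrow$. A typed interval on row $a$ is $[x\alpha,y\beta]$ with $\alpha\le\beta$ points of row $a$ and $x,y$ types; it is proper if $\alpha\neq\beta$, or $\alpha=\beta$ and $x=y\in\{\downarrow,\uparrow\}$. For typed intervals $t=[x\alpha,y\beta]$, $t'=[x'\alpha',y'\beta']$ on row $a$ and an endpoint $z\gamma\in\{x'\alpha',y'\beta'\}$ of $t'$, $t$ is coherent with $z\gamma$ if (i)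 $\alpha<\gamma<\beta$, or (ii) $z=\emptyset$ and $[\alpha,\beta]$ contains the grid edge of $[\alpha',\beta']$ incident to $\gamma$, or (iii) $z\neq\emptyset$ and $z\gamma\in\{x\alpha,y\beta\}$. $t$ contains $t'$ if $[\alpha',\beta']\subseteq[\alpha,\beta]$ and $t$ is coherent with both endpoints of $t'$. $t$ intersects $t'$ if $[\alpha,\beta]\cap[\alpha',\beta']$ contains a grid edge, or $t$ is coherent with an endpoint of $t'$, or $t'$ is coherent with an endpoint of $t$. The t-projection of $u$ on $a$ is $[x\alpha,y\beta]$ where $[\alpha,\beta]=P_u^a$ and the type of an extremity $\gamma$ is $\emptyset$ if $P_u$ stops at $\gamma$, $\downarrow$ if $P_u$ bends downwards at $\gamma$, $\uparrow$ if it bends upwards at $\gamma$. A vertex contains (resp. intersects) a typed interval $t$ on row $a$ if $a$ is in its index and its t-projection on $a$ contains (resp. intersects) $t$. The projection graph of a set $Y$ of vertices whose index contains $a$ is the graph on vertex set $Y$ in which two vertices are adjacent iff their t-projections on $a$ intersect. -}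

module Defs where

open import Data.Nat as ℕ using (ℕ)
open import Data.Integer as ℤ using (ℤ)
open import Data.Bool using (Bool; true; false; if_then_else_; _xor_)
open import Data.List using (List; []; _∷_; _∷ʳ_; length)
open import Data.List.Relation.Unary.Linked using (Linked)
open import Data.List.Relation.Unary.Unique.Propositional using (Unique)
open import Data.Product using (Σ; ∃; ∃-syntax; _×_; _,_; proj₁; proj₂)
open import Data.Sum using (_⊎_)
open import Data.Fin using (Fin)
open import Relation.Nullary using (¬_; does)
open import Relation.Binary.PropositionalEquality using (_≡_; _≢_)

-- A grid point is (x , y) : ℤ × ℤ ; the row
-- with index a is the horizontal line y = a, a column is a line x = α.
-- The point of row a at column α is (α , a); on a fixed row we identify
-- it with α.  "Downwards" means towards smaller y.

Point : Set
Point = ℤ × ℤ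

Step : Point → Point → Set
Step (x , y) (x' , y') =
  (y ≡ y' × (x' ≡ ℤ.suc x ⊎ x ≡ ℤ.suc x')) ⊎
  (x ≡ x' × (y' ≡ ℤ.suc y ⊎ y ≡ ℤ.suc y'))

record GridPath : Set where
  constructor mkPath
  field
    pts      : List Point
    linked   : Linked Step pts
    simple   : Unique pts
    nontriv  : 2 ℕ.≤ length pts
open GridPath public

data Consec : List Point → Point → Point → Set where
  here  : ∀ {p q rs} → Consec (p ∷ q ∷ rs) p q
  there : ∀ {r rs p q} → Consec rs p q → Consec (r ∷ rs) p q

EdgeIn : GridPath → Point → Point → Set
EdgeIn P p q = Consec (pts P) p q ⊎ Consec (pts P) q p

ShareEdge : GridPath → GridPath → Set
ShareEdge P Q = ∃[ p ] ∃[ q ] (EdgeIn P p q × EdgeIn Q p q)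

StopsAt : GridPath → Point → Set
StopsAt P γ = (∃[ rs ] pts P ≡ γ ∷ rs) ⊎ (∃[ rs ] pts P ≡ rs ∷ʳ γ)

isHoriz : Point → Point → Bool
isHoriz (_ , y) (_ , y') = does (y ℤ.≟ y')

bendsL : List Point → ℕ
bendsL (p ∷ rest@(q ∷ r ∷ rs)) =
  (if isHoriz p q xor isHoriz q r then 1 else 0) ℕ.+ bendsL rest
bendsL _ = 0

bends : GridPath → ℕ
bends P = bendsL (pts P)

record Graph (n : ℕ) : Set₁ where
  field
    Adj     : Fin n → Fin n → Set
    sym     : ∀ {u v} → Adj u v → Adj v u
    irrefl  : ∀ {u} → ¬ Adj u u
open Graph public

record B2Rep {n : ℕ} (G : Graph n) : Set where
  field
    path     : Fin n → GridPath
    twoBends : ∀ u → bends (path u) ℕ.≤ 2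
    adjIff   : ∀ u v → u ≢ v →
               (Adj G u v → ShareEdge (path u) (path v)) ×
               (ShareEdge (path u) (path v) → Adj G u v)
open B2Rep public

IntersectsRow : GridPath → ℤ → Set
IntersectsRow P a = ∃[ α ] EdgeIn P (α , a) (ℤ.suc α , a)

IndexIs1 : GridPath → ℤ → Set
IndexIs1 P a = ∀ r → (IntersectsRow P r → r ≡ a) × (r ≡ a → IntersectsRow P r)

IndexIs2 : GridPath → ℤ → ℤ → Set
IndexIs2 P a b = ∀ r → (IntersectsRow P r → r ≡ a ⊎ r ≡ b) ×
                       (r ≡ a ⊎ r ≡ b → IntersectsRow P r)

data Ty : Set where
  ∅ ↓ ↑ : Ty

record TInterval : Set where
  constructor ⟦_,_,_,_⟧
  field
    lty : Ty
    lpt : ℤ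
    rty : Ty
    rpt : ℤ
open TInterval public

WellFormed : TInterval → Set
WellFormed t = lpt t ℤ.≤ rpt t

Proper : TInterval → Set
Proper t = WellFormed t ×
  (lpt t ≢ rpt t ⊎ (lpt t ≡ rpt t × lty t ≡ rty t × lty t ≢ ∅))

IsEndpointOf : Ty → ℤ → TInterval → Set
IsEndpointOf z γ t = (z ≡ lty t × γ ≡ lpt t) ⊎ (z ≡ rty t × γ ≡ rpt t)

-- t coherent with the left endpoint x'α' of t'
-- (the grid edge of [α',β'] incident to α' is [α', α'+1])
CohL : TInterval → TInterval → Set
CohL t t' =
  (lpt t ℤ.< lpt t' × lpt t' ℤ.< rpt t) ⊎
  (lty t' ≡ ∅ × lpt t' ℤ.< rpt t' × lpt t ℤ.≤ lpt t' × ℤ.suc (lpt t') ℤ.≤ rpt t) ⊎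
  (lty t' ≢ ∅ × IsEndpointOf (lty t') (lpt t') t)

-- t coherent with the right endpoint y'β' of t'
-- (the grid edge of [α',β'] incident to β' is [β'-1, β'])
CohR : TInterval → TInterval → Set
CohR t t' =
  (lpt t ℤ.< rpt t' × rpt t' ℤ.< rpt t) ⊎
  (rty t' ≡ ∅ × lpt t' ℤ.< rpt t' × lpt t ℤ.≤ ℤ.pred (rpt t') × rpt t' ℤ.≤ rpt t) ⊎
  (rty t' ≢ ∅ × IsEndpointOf (rty t') (rpt t') t)

Contains : TInterval → TInterval → Set
Contains t t' = lpt t ℤ.≤ lpt t' × rpt t' ℤ.≤ rpt t × CohL t t' × CohR t t'

Intersects : TInterval → TInterval → Set
Intersects t t' =
  (∃[ k ] (lpt t ℤ.≤ k × ℤ.suc k ℤ.≤ rpt t × lpt t' ℤ.≤ k × ℤ.suc k ℤ.≤ rpt t')) ⊎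
  CohL t t' ⊎ CohR t t' ⊎ CohL t' t ⊎ CohR t' t

TypeAt : GridPath → ℤ → ℤ → Ty → Set
TypeAt P a α ∅ = StopsAt P (α , a)
TypeAt P a α ↓ = EdgeIn P (α , a) (α , ℤ.pred a)
TypeAt P a α ↑ = EdgeIn P (α , a) (α , ℤ.suc a)

Extremity : GridPath → ℤ → ℤ → Ty → Set
Extremity P a α z =
  (EdgeIn P (ℤ.pred α , a) (α , a) ⊎ EdgeIn P (α , a) (ℤ.suc α , a)) ×
  TypeAt P a α z

TProj : GridPath → ℤ → TInterval → Set
TProj P a t = lpt t ℤ.< rpt t ×
  Extremity P a (lpt t) (lty t) × Extremity P a (rpt t) (rty t)

PContains : GridPath → ℤ → TInterval → Set
PContains P a t = IntersectsRow P a × ∃[ t' ] (TProj P a t' × Contains t' t)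

PIntersects : GridPath → ℤ → TInterval → Set
PIntersects P a t = IntersectsRow P a × ∃[ t' ] (TProj P a t' × Intersects t' t)

ProjAdj : GridPath → GridPath → ℤ → Set
ProjAdj P Q a = ∃[ tP ] ∃[ tQ ] (TProj P a tP × TProj Q a tQ × Intersects tP tQ)

module Submission where

-- A path with at most two bends that uses row a is a segment [α , β] of row a with a leg at
-- each end, and its t-projection on a records the segment and how each leg leaves the row.
-- For two paths whose only common row is a, sharing a grid edge amounts to their t-projections
-- sharing a unit interval of row a or a bend endpoint of the same type. Every vertex of Y also
-- uses row b, so all its bends on a point towards b. Let m be the least right end and M the
-- greatest left end of the t-projections of Y; two of them are disjoint, so m ≤ M. The interval
-- from m to M, where an end gets the common bend type if every projection ending there bends
-- there and is otherwise pushed one unit outwards with type ∅, is met by every projection of Y,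
-- and a t-projection contains it exactly when it meets all of them.

open import Defs hiding (sym)
open import Data.Bool using (Bool; true; false; if_then_else_; _xor_)
open import Data.Empty using (⊥; ⊥-elim)
open import Data.Unit using (⊤)
open import Data.Nat as ℕ using (ℕ; suc)
open import Data.Integer as ℤ using (ℤ; _≤_; _<_)
import Data.Integer.Properties as ℤP
open import Data.Product using (∃; ∃-syntax; _×_; _,_; proj₁; proj₂) renaming (map to map×)
open import Data.Product.Properties using (,-injectiveˡ; ,-injectiveʳ)
open import Data.Sum using (_⊎_; inj₁; inj₂; swap; [_,_]) renaming (map to map⊎)
open import Data.List as List using (List; []; _∷_; _∷ʳ_; length)
open import Data.List.Properties using (∷-injectiveʳ)
open import Data.List.Relation.Unary.Linked using (Linked; [-]; _∷_)
import Data.List.Relation.Unary.All as All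
open import Data.List.Relation.Unary.All using (_∷_)
open import Data.List.Relation.Unary.AllPairs using (_∷_)
open import Data.List.Relation.Unary.Any using (here; there)
open import Data.List.Relation.Unary.Unique.Propositional using (Unique)
open import Data.List.Membership.Propositional using () renaming (_∈_ to _∈ₗ_)
open import Data.List.Membership.Propositional.Properties using (∈-map⁺; ∈-map⁻)
open import Data.List.Extrema ℤP.≤-totalOrder
  using (argmin; argmax; f[argmin]≤f[xs]; f[xs]≤f[argmax]; argmin-all; argmax-all)
import Data.Fin as Fin
open import Data.Fin.Subset using (Subset; _∈_)
open import Data.Vec using ([]; _∷_; here; there)
open import Function using (_∘_; id)
open import Relation.Binary using (tri<; tri≈; tri>)
open import Relation.Binary.PropositionalEquality using (_≡_; _≢_; refl; sym; trans; cong; subst; ≢-sym)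
open import Relation.Nullary using (¬_; Dec; does; yes; no)
open import Relation.Nullary.Decidable using (dec-true; dec-false; _→-dec_)

i<suc[i] : ∀ i → i < ℤ.suc i
i<suc[i] i = ℤP.suc[i]≤j⇒i<j ℤP.≤-refl

pred[i]<i : ∀ i → ℤ.pred i < i
pred[i]<i i = ℤP.i≤pred[j]⇒i<j ℤP.≤-refl

i<suc[j]⇒i≤j : ∀ {i j} → i < ℤ.suc j → i ≤ j
i<suc[j]⇒i≤j {i} {j} h = subst (i ≤_) (ℤP.pred-suc j) (ℤP.i<j⇒i≤pred[j] h)

i≤j⇒i<suc[j] : ∀ {i j} → i ≤ j → i < ℤ.suc j
i≤j⇒i<suc[j] h = ℤP.suc[i]≤j⇒i<j (ℤP.suc-mono h)

suc[i]≢i : ∀ i → ℤ.suc i ≢ i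
suc[i]≢i i = ≢-sym ℤP.i≢suc[i]

suc[suc[i]]≢i : ∀ i → ℤ.suc (ℤ.suc i) ≢ i
suc[suc[i]]≢i i e = ℤP.<-irrefl (sym e) (ℤP.<-trans (i<suc[i] i) (i<suc[i] (ℤ.suc i)))

pred[i]≢i : ∀ i → ℤ.pred i ≢ i
pred[i]≢i i e = ℤP.<-irrefl e (pred[i]<i i)

point-injective : ∀ {x y x′ y′ : ℤ} → _≡_ {A = Point} (x , y) (x′ , y′) → x ≡ x′ × y ≡ y′
point-injective e = ,-injectiveˡ e , ,-injectiveʳ e

data Dir : Set where
  E W N S : Dir

step : Dir → Point → Point
step E (x , y) = (ℤ.suc x , y)
step W (x , y) = (ℤ.pred x , y)
step N (x , y) = (x , ℤ.suc y)
step S (x , y) = (x , ℤ.pred y)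

horizontal : Dir → Bool
horizontal E = true
horizontal W = true
horizontal N = false
horizontal S = false

isHoriz-step : ∀ d p → isHoriz p (step d p) ≡ horizontal d
isHoriz-step E (x , y) = dec-true (y ℤ.≟ y) refl
isHoriz-step W (x , y) = dec-true (y ℤ.≟ y) refl
isHoriz-step N (x , y) = dec-false (y ℤ.≟ ℤ.suc y) ℤP.i≢suc[i]
isHoriz-step S (x , y) = dec-false (y ℤ.≟ ℤ.pred y) (≢-sym (pred[i]≢i y))

Step⇒step : ∀ {p q} → Step p q → ∃[ d ] (q ≡ step d p)
Step⇒step {x , y} {x′ , y′} (inj₁ (refl , inj₁ refl)) = E , refl
Step⇒step {x , y} {x′ , y′} (inj₁ (refl , inj₂ refl)) = W , cong (_, y) (sym (ℤP.pred-suc x′))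
Step⇒step {x , y} {x′ , y′} (inj₂ (refl , inj₁ refl)) = N , refl
Step⇒step {x , y} {x′ , y′} (inj₂ (refl , inj₂ refl)) = S , cong (x ,_) (sym (ℤP.pred-suc y′))

UnitBetween : ℤ → ℤ → ℤ → Set
UnitBetween x x′ k = (x ≤ k × k < x′) ⊎ (x′ ≤ k × k < x)

SameEdge : Point → Point → Point → Point → Set
SameEdge p q u v = (u ≡ p × v ≡ q) ⊎ (u ≡ q × v ≡ p)

HUnit : ℤ → ℤ → Point → Point → Set
HUnit k r u v = SameEdge (k , r) (ℤ.suc k , r) u v

VUnit : ℤ → ℤ → Point → Point → Set
VUnit c k u v = SameEdge (c , k) (c , ℤ.suc k) u v

OnSegment : Point → Point → Point → Point → Set
OnSegment (x , y) (x′ , y′) u v =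
  (y ≡ y′ × ∃[ k ] (UnitBetween x x′ k × HUnit k y u v)) ⊎
  (x ≡ x′ × ∃[ k ] (UnitBetween y y′ k × VUnit x k u v))

sameEdge-swap : ∀ {p q u v} → SameEdge p q u v → SameEdge p q v u
sameEdge-swap (inj₁ (e₁ , e₂)) = inj₂ (e₂ , e₁)
sameEdge-swap (inj₂ (e₁ , e₂)) = inj₁ (e₂ , e₁)

unitBetween-sym : ∀ {x x′ k} → UnitBetween x x′ k → UnitBetween x′ x k
unitBetween-sym = swap

unitBetween⇒≢ : ∀ {x x′ k} → UnitBetween x x′ k → x ≢ x′
unitBetween⇒≢ (inj₁ (h₁ , h₂)) refl = ℤP.≤⇒≯ h₁ h₂
unitBetween⇒≢ (inj₂ (h₁ , h₂)) refl = ℤP.≤⇒≯ h₁ h₂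

unitBetween-suc : ∀ {x k} → UnitBetween x (ℤ.suc x) k → k ≡ x
unitBetween-suc (inj₁ (h₁ , h₂)) = ℤP.≤-antisym (i<suc[j]⇒i≤j h₂) h₁
unitBetween-suc {x} (inj₂ (h₁ , h₂)) = ⊥-elim (ℤP.≤⇒≯ h₁ (ℤP.<-trans h₂ (i<suc[i] x)))

unitBetween-pred : ∀ {x k} → UnitBetween x (ℤ.pred x) k → k ≡ ℤ.pred x
unitBetween-pred {x} (inj₁ (h₁ , h₂)) = ⊥-elim (ℤP.≤⇒≯ h₁ (ℤP.<-trans h₂ (pred[i]<i x)))
unitBetween-pred (inj₂ (h₁ , h₂)) = ℤP.≤-antisym (ℤP.i<j⇒i≤pred[j] h₂) h₁

onSegment-swap : ∀ p q {u v} → OnSegment p q u v → OnSegment p q v u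
onSegment-swap p q = map⊎ (λ (e , k , b , h) → e , k , b , sameEdge-swap h)
                          (λ (e , k , b , h) → e , k , b , sameEdge-swap h)

onSegment-reverse : ∀ p q {u v} → OnSegment p q u v → OnSegment q p u v
onSegment-reverse p q (inj₁ (e , k , b , h)) =
  inj₁ (sym e , k , unitBetween-sym b , subst (λ z → HUnit k z _ _) e h)
onSegment-reverse p q (inj₂ (e , k , b , h)) =
  inj₂ (sym e , k , unitBetween-sym b , subst (λ z → VUnit z k _ _) e h)

onSegment-step : ∀ d p → OnSegment p (step d p) p (step d p)
onSegment-step E (x , y) = inj₁ (refl , x , inj₁ (ℤP.≤-refl , i<suc[i] x) , inj₁ (refl , refl))
onSegment-step W (x , y) = inj₁ (refl , ℤ.pred x , inj₂ (ℤP.≤-refl , pred[i]<i x) ,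
                                 inj₂ (cong (_, y) (sym (ℤP.suc-pred x)) , refl))
onSegment-step N (x , y) = inj₂ (refl , y , inj₁ (ℤP.≤-refl , i<suc[i] y) , inj₁ (refl , refl))
onSegment-step S (x , y) = inj₂ (refl , ℤ.pred y , inj₂ (ℤP.≤-refl , pred[i]<i y) ,
                                 inj₂ (cong (x ,_) (sym (ℤP.suc-pred y)) , refl))

sameEdge-flip : ∀ {p q u v} → SameEdge p q u v → SameEdge q p u v
sameEdge-flip = swap

onSegment-hUnit : ∀ {x₀ y₀ x₁ y₁ k a} → OnSegment (x₀ , y₀) (x₁ , y₁) (k , a) (ℤ.suc k , a) →
                  y₀ ≡ a × y₁ ≡ a × UnitBetween x₀ x₁ k
onSegment-hUnit (inj₁ (e , _ , b , inj₁ (e₁ , _))) with point-injective e₁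
... | refl , refl = refl , sym e , b
onSegment-hUnit (inj₁ (_ , _ , _ , inj₂ (e₁ , e₂))) =
  ⊥-elim (suc[suc[i]]≢i _ (trans (cong ℤ.suc (sym (proj₁ (point-injective e₁)))) (proj₁ (point-injective e₂))))
onSegment-hUnit (inj₂ (_ , _ , _ , inj₁ (e₁ , e₂))) =
  ⊥-elim (suc[i]≢i _ (trans (proj₁ (point-injective e₂)) (sym (proj₁ (point-injective e₁)))))
onSegment-hUnit (inj₂ (_ , _ , _ , inj₂ (e₁ , e₂))) =
  ⊥-elim (suc[i]≢i _ (trans (proj₁ (point-injective e₂)) (sym (proj₁ (point-injective e₁)))))

onSegment-vUnit : ∀ {x₀ y₀ x₁ y₁ c r} → OnSegment (x₀ , y₀) (x₁ , y₁) (c , r) (c , ℤ.suc r) →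
                  x₀ ≡ c × x₁ ≡ c × UnitBetween y₀ y₁ r
onSegment-vUnit (inj₂ (e , _ , b , inj₁ (e₁ , _))) with point-injective e₁
... | refl , refl = refl , sym e , b
onSegment-vUnit (inj₂ (_ , _ , _ , inj₂ (e₁ , e₂))) =
  ⊥-elim (suc[suc[i]]≢i _ (trans (cong ℤ.suc (sym (proj₂ (point-injective e₁)))) (proj₂ (point-injective e₂))))
onSegment-vUnit (inj₁ (_ , _ , _ , inj₁ (e₁ , e₂))) =
  ⊥-elim (suc[i]≢i _ (trans (proj₂ (point-injective e₂)) (sym (proj₂ (point-injective e₁)))))
onSegment-vUnit (inj₁ (_ , _ , _ , inj₂ (e₁ , e₂))) =
  ⊥-elim (suc[i]≢i _ (trans (proj₂ (point-injective e₂)) (sym (proj₂ (point-injective e₁)))))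

onSegment-of-step : ∀ d p {u v} → OnSegment p (step d p) u v → SameEdge p (step d p) u v
onSegment-of-step E (x , y) (inj₁ (_ , _ , b , h)) with unitBetween-suc b
... | refl = h
onSegment-of-step E (x , y) (inj₂ (e , _)) = ⊥-elim (suc[i]≢i x (sym e))
onSegment-of-step W (x , y) (inj₁ (_ , _ , b , h)) with unitBetween-pred b
... | refl = sameEdge-flip (subst (λ z → SameEdge (ℤ.pred x , y) (z , y) _ _) (ℤP.suc-pred x) h)
onSegment-of-step W (x , y) (inj₂ (e , _)) = ⊥-elim (pred[i]≢i x (sym e))
onSegment-of-step N (x , y) (inj₁ (e , _)) = ⊥-elim (suc[i]≢i y (sym e))
onSegment-of-step N (x , y) (inj₂ (_ , _ , b , h)) with unitBetween-suc b
... | refl = h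
onSegment-of-step S (x , y) (inj₁ (e , _)) = ⊥-elim (pred[i]≢i y (sym e))
onSegment-of-step S (x , y) (inj₂ (_ , _ , b , h)) with unitBetween-pred b
... | refl = sameEdge-flip (subst (λ z → SameEdge (x , ℤ.pred y) (x , z) _ _) (ℤP.suc-pred y) h)

Ahead : Dir → Point → Point → Set
Ahead E (x , y) (wx , wy) = y ≡ wy × x < wx
Ahead W (x , y) (wx , wy) = y ≡ wy × wx < x
Ahead N (x , y) (wx , wy) = x ≡ wx × y < wy
Ahead S (x , y) (wx , wy) = x ≡ wx × wy < y

unitBetween-from : ∀ {x x′} → UnitBetween x x′ x → x < x′
unitBetween-from (inj₁ (_ , h)) = h
unitBetween-from (inj₂ (_ , h)) = ⊥-elim (ℤP.<-irrefl refl h)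

unitBetween-before : ∀ {x x′} → UnitBetween x x′ (ℤ.pred x) → x′ < x
unitBetween-before {x} (inj₁ (h , _)) = ⊥-elim (ℤP.≤⇒≯ h (pred[i]<i x))
unitBetween-before (inj₂ (h , _)) = ℤP.i≤pred[j]⇒i<j h

ahead-of-first-step : ∀ d q w → OnSegment q w q (step d q) → Ahead d q w
ahead-of-first-step E (x , y) (wx , wy) s with onSegment-hUnit s
... | _ , e , b = sym e , unitBetween-from b
ahead-of-first-step W (x , y) (wx , wy) s
  with onSegment-hUnit (subst (λ z → OnSegment (x , y) (wx , wy) (ℤ.pred x , y) (z , y))
                              (sym (ℤP.suc-pred x)) (onSegment-swap (x , y) (wx , wy) s))
... | _ , e , b = sym e , unitBetween-before b
ahead-of-first-step N (x , y) (wx , wy) s with onSegment-vUnit s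
... | _ , e , b = sym e , unitBetween-from b
ahead-of-first-step S (x , y) (wx , wy) s
  with onSegment-vUnit (subst (λ z → OnSegment (x , y) (wx , wy) (x , ℤ.pred y) (x , z))
                              (sym (ℤP.suc-pred y)) (onSegment-swap (x , y) (wx , wy) s))
... | _ , e , b = sym e , unitBetween-before b

StrictlyBetween : ℤ → ℤ → ℤ → Set
StrictlyBetween x₀ x₁ x₂ = (x₀ < x₁ × x₁ < x₂) ⊎ (x₂ < x₁ × x₁ < x₀)

strictlyBetween-≢₀₁ : ∀ {x₀ x₁ x₂} → StrictlyBetween x₀ x₁ x₂ → x₀ ≢ x₁
strictlyBetween-≢₀₁ (inj₁ (h , _)) = ℤP.<⇒≢ h
strictlyBetween-≢₀₁ (inj₂ (_ , h)) = ≢-sym (ℤP.<⇒≢ h)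

strictlyBetween-≢₁₂ : ∀ {x₀ x₁ x₂} → StrictlyBetween x₀ x₁ x₂ → x₁ ≢ x₂
strictlyBetween-≢₁₂ (inj₁ (_ , h)) = ℤP.<⇒≢ h
strictlyBetween-≢₁₂ (inj₂ (h , _)) = ≢-sym (ℤP.<⇒≢ h)

strictlyBetween-≢₀₂ : ∀ {x₀ x₁ x₂} → StrictlyBetween x₀ x₁ x₂ → x₀ ≢ x₂
strictlyBetween-≢₀₂ (inj₁ (h₁ , h₂)) = ℤP.<⇒≢ (ℤP.<-trans h₁ h₂)
strictlyBetween-≢₀₂ (inj₂ (h₁ , h₂)) = ≢-sym (ℤP.<⇒≢ (ℤP.<-trans h₁ h₂))

unitBetween-split< : ∀ {x₀ x₁ x₂ k} → x₀ < x₁ → x₁ < x₂ → UnitBetween x₀ x₂ k →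
                     UnitBetween x₀ x₁ k ⊎ UnitBetween x₁ x₂ k
unitBetween-split< {x₁ = x₁} {k = k} _ _ (inj₁ (h₁ , h₂)) with k ℤP.<? x₁
... | yes k<x₁ = inj₁ (inj₁ (h₁ , k<x₁))
... | no k≮x₁ = inj₂ (inj₁ (ℤP.≮⇒≥ k≮x₁ , h₂))
unitBetween-split< x₀<x₁ x₁<x₂ (inj₂ (h₁ , h₂)) =
  ⊥-elim (ℤP.≤⇒≯ h₁ (ℤP.<-trans h₂ (ℤP.<-trans x₀<x₁ x₁<x₂)))

unitBetween-join< : ∀ {x₀ x₁ x₂ k} → x₀ < x₁ → x₁ < x₂ →
                    UnitBetween x₀ x₁ k ⊎ UnitBetween x₁ x₂ k → UnitBetween x₀ x₂ k
unitBetween-join< _ x₁<x₂ (inj₁ (inj₁ (h₁ , h₂))) = inj₁ (h₁ , ℤP.<-trans h₂ x₁<x₂)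
unitBetween-join< x₀<x₁ _ (inj₁ (inj₂ (h₁ , h₂))) = ⊥-elim (ℤP.≤⇒≯ h₁ (ℤP.<-trans h₂ x₀<x₁))
unitBetween-join< x₀<x₁ _ (inj₂ (inj₁ (h₁ , h₂))) = inj₁ (ℤP.<⇒≤ (ℤP.<-≤-trans x₀<x₁ h₁) , h₂)
unitBetween-join< _ x₁<x₂ (inj₂ (inj₂ (h₁ , h₂))) = ⊥-elim (ℤP.≤⇒≯ h₁ (ℤP.<-trans h₂ x₁<x₂))

unitBetween-split : ∀ {x₀ x₁ x₂ k} → StrictlyBetween x₀ x₁ x₂ → UnitBetween x₀ x₂ k →
                    UnitBetween x₀ x₁ k ⊎ UnitBetween x₁ x₂ k
unitBetween-split (inj₁ (h₁ , h₂)) b = unitBetween-split< h₁ h₂ b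
unitBetween-split (inj₂ (h₁ , h₂)) b =
  swap (map⊎ unitBetween-sym unitBetween-sym (unitBetween-split< h₁ h₂ (unitBetween-sym b)))

unitBetween-join : ∀ {x₀ x₁ x₂ k} → StrictlyBetween x₀ x₁ x₂ →
                   UnitBetween x₀ x₁ k ⊎ UnitBetween x₁ x₂ k → UnitBetween x₀ x₂ k
unitBetween-join (inj₁ (h₁ , h₂)) b = unitBetween-join< h₁ h₂ b
unitBetween-join (inj₂ (h₁ , h₂)) b =
  unitBetween-sym (unitBetween-join< h₁ h₂ (map⊎ unitBetween-sym unitBetween-sym (swap b)))

onSegment-splitₕ : ∀ {y x₀ x₁ x₂ u v} → StrictlyBetween x₀ x₁ x₂ → OnSegment (x₀ , y) (x₂ , y) u v →
                   OnSegment (x₀ , y) (x₁ , y) u v ⊎ OnSegment (x₁ , y) (x₂ , y) u v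
onSegment-splitₕ m (inj₁ (e , k , b , h)) =
  map⊎ (λ b′ → inj₁ (e , k , b′ , h)) (λ b′ → inj₁ (e , k , b′ , h)) (unitBetween-split m b)
onSegment-splitₕ m (inj₂ (e , _)) = ⊥-elim (strictlyBetween-≢₀₂ m e)

onSegment-joinₕ : ∀ {y x₀ x₁ x₂ u v} → StrictlyBetween x₀ x₁ x₂ →
                  OnSegment (x₀ , y) (x₁ , y) u v ⊎ OnSegment (x₁ , y) (x₂ , y) u v →
                  OnSegment (x₀ , y) (x₂ , y) u v
onSegment-joinₕ m (inj₁ (inj₁ (e , k , b , h))) = inj₁ (e , k , unitBetween-join m (inj₁ b) , h)
onSegment-joinₕ m (inj₁ (inj₂ (e , _))) = ⊥-elim (strictlyBetween-≢₀₁ m e)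
onSegment-joinₕ m (inj₂ (inj₁ (e , k , b , h))) = inj₁ (e , k , unitBetween-join m (inj₂ b) , h)
onSegment-joinₕ m (inj₂ (inj₂ (e , _))) = ⊥-elim (strictlyBetween-≢₁₂ m e)

onSegment-splitᵥ : ∀ {x y₀ y₁ y₂ u v} → StrictlyBetween y₀ y₁ y₂ → OnSegment (x , y₀) (x , y₂) u v →
                   OnSegment (x , y₀) (x , y₁) u v ⊎ OnSegment (x , y₁) (x , y₂) u v
onSegment-splitᵥ m (inj₂ (e , k , b , h)) =
  map⊎ (λ b′ → inj₂ (e , k , b′ , h)) (λ b′ → inj₂ (e , k , b′ , h)) (unitBetween-split m b)
onSegment-splitᵥ m (inj₁ (e , _)) = ⊥-elim (strictlyBetween-≢₀₂ m e)

onSegment-joinᵥ : ∀ {x y₀ y₁ y₂ u v} → StrictlyBetween y₀ y₁ y₂ →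
                  OnSegment (x , y₀) (x , y₁) u v ⊎ OnSegment (x , y₁) (x , y₂) u v →
                  OnSegment (x , y₀) (x , y₂) u v
onSegment-joinᵥ m (inj₁ (inj₂ (e , k , b , h))) = inj₂ (e , k , unitBetween-join m (inj₁ b) , h)
onSegment-joinᵥ m (inj₁ (inj₁ (e , _))) = ⊥-elim (strictlyBetween-≢₀₁ m e)
onSegment-joinᵥ m (inj₂ (inj₂ (e , k , b , h))) = inj₂ (e , k , unitBetween-join m (inj₂ b) , h)
onSegment-joinᵥ m (inj₂ (inj₁ (e , _))) = ⊥-elim (strictlyBetween-≢₁₂ m e)

Aligned : Point → Point → Set
Aligned (x , y) (x′ , y′) = (y ≡ y′ × x ≢ x′) ⊎ (x ≡ x′ × y ≢ y′)

aligned-step : ∀ d p → Aligned p (step d p)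
aligned-step E (x , y) = inj₁ (refl , ≢-sym (suc[i]≢i x))
aligned-step W (x , y) = inj₁ (refl , ≢-sym (pred[i]≢i x))
aligned-step N (x , y) = inj₂ (refl , ≢-sym (suc[i]≢i y))
aligned-step S (x , y) = inj₂ (refl , ≢-sym (pred[i]≢i y))

record Subdivision (d : Dir) (p w : Point) : Set where
  field
    split    : ∀ {u v} → OnSegment p w u v → OnSegment p (step d p) u v ⊎ OnSegment (step d p) w u v
    join     : ∀ {u v} → OnSegment p (step d p) u v ⊎ OnSegment (step d p) w u v → OnSegment p w u v
    aligned  : Aligned p w
    isHoriz≡ : isHoriz p w ≡ isHoriz (step d p) w

subdivide : ∀ d p w → Ahead d (step d p) w → Subdivision d p w
subdivide E (x , y) (wx , .y) (refl , h) = record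
  { split = onSegment-splitₕ m ; join = onSegment-joinₕ m
  ; aligned = inj₁ (refl , strictlyBetween-≢₀₂ m) ; isHoriz≡ = refl }
  where m = inj₁ (i<suc[i] x , h)
subdivide W (x , y) (wx , .y) (refl , h) = record
  { split = onSegment-splitₕ m ; join = onSegment-joinₕ m
  ; aligned = inj₁ (refl , strictlyBetween-≢₀₂ m) ; isHoriz≡ = refl }
  where m = inj₂ (h , pred[i]<i x)
subdivide N (x , y) (.x , wy) (refl , h) = record
  { split = onSegment-splitᵥ m ; join = onSegment-joinᵥ m
  ; aligned = inj₂ (refl , strictlyBetween-≢₀₂ m)
  ; isHoriz≡ = trans (dec-false (y ℤ.≟ wy) (strictlyBetween-≢₀₂ m))
                     (sym (dec-false (ℤ.suc y ℤ.≟ wy) (strictlyBetween-≢₁₂ m))) }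
  where m = inj₁ (i<suc[i] y , h)
subdivide S (x , y) (.x , wy) (refl , h) = record
  { split = onSegment-splitᵥ m ; join = onSegment-joinᵥ m
  ; aligned = inj₂ (refl , strictlyBetween-≢₀₂ m)
  ; isHoriz≡ = trans (dec-false (y ℤ.≟ wy) (strictlyBetween-≢₀₂ m))
                     (sym (dec-false (ℤ.pred y ℤ.≟ wy) (strictlyBetween-≢₁₂ m))) }
  where m = inj₂ (h , pred[i]<i y)

OnPolyline : List Point → Point → Point → Set
OnPolyline (p ∷ q ∷ vs) u v = OnSegment p q u v ⊎ OnPolyline (q ∷ vs) u v
OnPolyline _ u v = ⊥

Alternating : List Point → Set
Alternating (p ∷ q ∷ []) = Aligned p q
Alternating (p ∷ q ∷ r ∷ vs) = Aligned p q × (isHoriz p q xor isHoriz q r ≡ true) × Alternating (q ∷ r ∷ vs)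
Alternating _ = ⊥

lastOf : Point → List Point → Point
lastOf p [] = p
lastOf p (q ∷ qs) = lastOf q qs

EdgeOf : List Point → Point → Point → Set
EdgeOf xs u v = Consec xs u v ⊎ Consec xs v u

edgeOf-there : ∀ {p xs u v} → EdgeOf xs u v → EdgeOf (p ∷ xs) u v
edgeOf-there = map⊎ there there

sameEdge⇒edgeOf : ∀ {p q qs u v} → SameEdge p q u v → EdgeOf (p ∷ q ∷ qs) u v
sameEdge⇒edgeOf (inj₁ (refl , refl)) = inj₁ here
sameEdge⇒edgeOf (inj₂ (refl , refl)) = inj₂ here

onSegment-isHoriz : ∀ q w {u v} → OnSegment q w u v → isHoriz q w ≡ isHoriz u v
onSegment-isHoriz (qx , qy) (wx , wy) (inj₁ (e , k , _ , inj₁ (refl , refl))) =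
  trans (dec-true (qy ℤ.≟ wy) e) (sym (dec-true (qy ℤ.≟ qy) refl))
onSegment-isHoriz (qx , qy) (wx , wy) (inj₁ (e , k , _ , inj₂ (refl , refl))) =
  trans (dec-true (qy ℤ.≟ wy) e) (sym (dec-true (qy ℤ.≟ qy) refl))
onSegment-isHoriz (qx , qy) (wx , wy) (inj₂ (e , k , b , inj₁ (refl , refl))) =
  trans (dec-false (qy ℤ.≟ wy) (unitBetween⇒≢ b)) (sym (dec-false (k ℤ.≟ ℤ.suc k) ℤP.i≢suc[i]))
onSegment-isHoriz (qx , qy) (wx , wy) (inj₂ (e , k , b , inj₂ (refl , refl))) =
  trans (dec-false (qy ℤ.≟ wy) (unitBetween⇒≢ b)) (sym (dec-false (ℤ.suc k ℤ.≟ k) (suc[i]≢i k)))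

alternating-replaceFirst : ∀ p q w vs → Aligned p w → isHoriz p w ≡ isHoriz q w →
                           Alternating (q ∷ w ∷ vs) → Alternating (p ∷ w ∷ vs)
alternating-replaceFirst p q w [] al _ _ = al
alternating-replaceFirst p q w (r ∷ vs) al h (_ , turn , alt) =
  al , trans (cong (_xor isHoriz w r) h) turn , alt

-- p ∷ q ∷ qs simplified to the polyline p ∷ next ∷ rest of its maximal straight runs
record Straightened (p q : Point) (qs : List Point) : Set where
  field
    next         : Point
    rest         : List Point
    edge⇒        : ∀ {u v} → EdgeOf (p ∷ q ∷ qs) u v → OnPolyline (p ∷ next ∷ rest) u v
    edge⇐        : ∀ {u v} → OnPolyline (p ∷ next ∷ rest) u v → EdgeOf (p ∷ q ∷ qs) u v
    last≡        : lastOf next rest ≡ lastOf q qs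
    alternating  : Alternating (p ∷ next ∷ rest)
    length≡bends : length rest ≡ bendsL (p ∷ q ∷ qs)
    firstRun     : OnSegment p next p q

straightened-edge : ∀ d p → Straightened p (step d p) []
straightened-edge d p = record
  { next = step d p ; rest = []
  ; edge⇒ = edge⇒ ; edge⇐ = λ { (inj₁ s) → sameEdge⇒edgeOf (onSegment-of-step d p s) }
  ; last≡ = refl ; alternating = aligned-step d p ; length≡bends = refl
  ; firstRun = onSegment-step d p }
  where
  edge⇒ : ∀ {u v} → EdgeOf (p ∷ step d p ∷ []) u v → OnPolyline (p ∷ step d p ∷ []) u v
  edge⇒ (inj₁ here) = inj₁ (onSegment-step d p)
  edge⇒ (inj₂ here) = inj₁ (onSegment-swap p _ (onSegment-step d p))
  edge⇒ (inj₁ (there (there ())))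
  edge⇒ (inj₂ (there (there ())))

straightened-turn : ∀ d p r rs → Straightened (step d p) r rs →
                    (isHoriz p (step d p) xor isHoriz (step d p) r) ≡ true →
                    Straightened p (step d p) (r ∷ rs)
straightened-turn d p r rs D turn = record
  { next = q ; rest = D.next ∷ D.rest
  ; edge⇒ = edge⇒ ; edge⇐ = edge⇐
  ; last≡ = D.last≡
  ; alternating = aligned-step d p ,
      trans (cong (isHoriz p q xor_) (onSegment-isHoriz q D.next D.firstRun)) turn , D.alternating
  ; length≡bends = trans (cong suc D.length≡bends)
      (cong (λ b → (if b then 1 else 0) ℕ.+ bendsL (q ∷ r ∷ rs)) (sym turn))
  ; firstRun = onSegment-step d p }
  where
  module D = Straightened D
  q = step d p
  edge⇒ : ∀ {u v} → EdgeOf (p ∷ q ∷ r ∷ rs) u v → OnPolyline (p ∷ q ∷ D.next ∷ D.rest) u v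
  edge⇒ (inj₁ here) = inj₁ (onSegment-step d p)
  edge⇒ (inj₂ here) = inj₁ (onSegment-swap p q (onSegment-step d p))
  edge⇒ (inj₁ (there c)) = inj₂ (D.edge⇒ (inj₁ c))
  edge⇒ (inj₂ (there c)) = inj₂ (D.edge⇒ (inj₂ c))
  edge⇐ : ∀ {u v} → OnPolyline (p ∷ q ∷ D.next ∷ D.rest) u v → EdgeOf (p ∷ q ∷ r ∷ rs) u v
  edge⇐ (inj₁ s) = sameEdge⇒edgeOf (onSegment-of-step d p s)
  edge⇐ (inj₂ e) = edgeOf-there (D.edge⇐ e)

straightened-straight : ∀ d p rs → Straightened (step d p) (step d (step d p)) rs →
                        Straightened p (step d p) (step d (step d p) ∷ rs)
straightened-straight d p rs D = record
  { next = D.next ; rest = D.rest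
  ; edge⇒ = edge⇒ ; edge⇐ = edge⇐
  ; last≡ = D.last≡
  ; alternating = alternating-replaceFirst p q D.next D.rest Sub.aligned Sub.isHoriz≡ D.alternating
  ; length≡bends = trans D.length≡bends
      (cong (λ b → (if b then 1 else 0) ℕ.+ bendsL (q ∷ r ∷ rs)) (sym no-turn))
  ; firstRun = Sub.join (inj₁ (onSegment-step d p)) }
  where
  module D = Straightened D
  q = step d p
  r = step d q
  module Sub = Subdivision (subdivide d p D.next (ahead-of-first-step d q D.next D.firstRun))
  no-turn : (isHoriz p q xor isHoriz q r) ≡ false
  no-turn rewrite isHoriz-step d p | isHoriz-step d q with horizontal d
  ... | true = refl
  ... | false = refl
  edge⇒ : ∀ {u v} → EdgeOf (p ∷ q ∷ r ∷ rs) u v → OnPolyline (p ∷ D.next ∷ D.rest) u v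
  edge⇒ (inj₁ here) = inj₁ (Sub.join (inj₁ (onSegment-step d p)))
  edge⇒ (inj₂ here) = inj₁ (Sub.join (inj₁ (onSegment-swap p q (onSegment-step d p))))
  edge⇒ (inj₁ (there c)) = map⊎ (Sub.join ∘ inj₂) id (D.edge⇒ (inj₁ c))
  edge⇒ (inj₂ (there c)) = map⊎ (Sub.join ∘ inj₂) id (D.edge⇒ (inj₂ c))
  edge⇐ : ∀ {u v} → OnPolyline (p ∷ D.next ∷ D.rest) u v → EdgeOf (p ∷ q ∷ r ∷ rs) u v
  edge⇐ (inj₁ s) with Sub.split s
  ... | inj₁ s′ = sameEdge⇒edgeOf (onSegment-of-step d p s′)
  ... | inj₂ s′ = edgeOf-there (D.edge⇐ (inj₁ s′))
  edge⇐ (inj₂ e) = edgeOf-there (D.edge⇐ (inj₂ e))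

data Opposite : Dir → Dir → Set where
  E-W : Opposite E W
  W-E : Opposite W E
  N-S : Opposite N S
  S-N : Opposite S N

step-opposite : ∀ {d d′} → Opposite d d′ → ∀ p → step d′ (step d p) ≡ p
step-opposite E-W (x , y) = cong (_, y) (ℤP.pred-suc x)
step-opposite W-E (x , y) = cong (_, y) (ℤP.suc-pred x)
step-opposite N-S (x , y) = cong (x ,_) (ℤP.pred-suc y)
step-opposite S-N (x , y) = cong (x ,_) (ℤP.suc-pred y)

same-opposite-or-turn : ∀ d d′ → d ≡ d′ ⊎ Opposite d d′ ⊎ (horizontal d xor horizontal d′) ≡ true
same-opposite-or-turn E E = inj₁ refl
same-opposite-or-turn W W = inj₁ refl
same-opposite-or-turn N N = inj₁ refl
same-opposite-or-turn S S = inj₁ refl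
same-opposite-or-turn E W = inj₂ (inj₁ E-W)
same-opposite-or-turn W E = inj₂ (inj₁ W-E)
same-opposite-or-turn N S = inj₂ (inj₁ N-S)
same-opposite-or-turn S N = inj₂ (inj₁ S-N)
same-opposite-or-turn E N = inj₂ (inj₂ refl)
same-opposite-or-turn E S = inj₂ (inj₂ refl)
same-opposite-or-turn W N = inj₂ (inj₂ refl)
same-opposite-or-turn W S = inj₂ (inj₂ refl)
same-opposite-or-turn N E = inj₂ (inj₂ refl)
same-opposite-or-turn N W = inj₂ (inj₂ refl)
same-opposite-or-turn S E = inj₂ (inj₂ refl)
same-opposite-or-turn S W = inj₂ (inj₂ refl)

straighten : ∀ p q qs → Linked Step (p ∷ q ∷ qs) → Unique (p ∷ q ∷ qs) → Straightened p q qs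
straighten p q [] (st ∷ [-]) _ with Step⇒step st
... | d , refl = straightened-edge d p
straighten p q (r ∷ rs) (st ∷ st′ ∷ lk) ((_ ∷ p≢r ∷ _) ∷ un)
  with Step⇒step st | Step⇒step st′ | straighten q r rs (st′ ∷ lk) un
... | d , refl | d′ , refl | rest with same-opposite-or-turn d d′
...   | inj₁ refl = straightened-straight d p rs rest
...   | inj₂ (inj₁ o) = ⊥-elim (p≢r (sym (step-opposite o p)))
...   | inj₂ (inj₂ turn) = straightened-turn d p _ rs rest turn′
  where
  turn′ : (isHoriz p (step d p) xor isHoriz (step d p) (step d′ (step d p))) ≡ true
  turn′ rewrite isHoriz-step d p | isHoriz-step d′ (step d p) = turn

-- A path with at most two bends, seen from a row it uses

-- a leg at column c leaves row a vertically for row y, then possibly runs along row y to column x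
data Tail (c y : ℤ) : Set where
  noTail : Tail c y
  tail   : (x : ℤ) → x ≢ c → Tail c y

data Leg (c a : ℤ) : Set where
  stop : Leg c a
  turn : (y : ℤ) → y ≢ a → Tail c y → Leg c a

LegEdge : ∀ {c a} → Leg c a → Point → Point → Set
LegEdge stop u v = ⊥
LegEdge {c} {a} (turn y _ noTail) u v = OnSegment (c , a) (c , y) u v
LegEdge {c} {a} (turn y _ (tail x _)) u v = OnSegment (c , a) (c , y) u v ⊎ OnSegment (c , y) (x , y) u v

legEnd : ∀ {c a} → Leg c a → Point
legEnd {c} {a} stop = c , a
legEnd {c} (turn y _ noTail) = c , y
legEnd (turn y _ (tail x _)) = x , y

HasTail : ∀ {c a} → Leg c a → Set
HasTail (turn _ _ (tail _ _)) = ⊤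
HasTail _ = ⊥

IsStop : ∀ {c a} → Leg c a → Set
IsStop stop = ⊤
IsStop (turn _ _ _) = ⊥

-- a path (given by its unit edges Ed and end points St) made of the segment [α , β] of row a
-- and a leg at each end; with two bends only one leg can have a tail
record RowShape (Ed : Point → Point → Set) (St : Point → Set) (a : ℤ) : Set where
  field
    α β         : ℤ
    α<β         : α < β
    L           : Leg α a
    R           : Leg β a
    tailᴸ⇒stopᴿ : HasTail L → IsStop R
    tailᴿ⇒stopᴸ : HasTail R → IsStop L
    edge⇒       : ∀ {u v} → Ed u v → OnSegment (α , a) (β , a) u v ⊎ LegEdge L u v ⊎ LegEdge R u v
    edge⇐       : ∀ {u v} → OnSegment (α , a) (β , a) u v ⊎ LegEdge L u v ⊎ LegEdge R u v → Ed u v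
    stop⇒       : ∀ {γ} → St γ → γ ≡ legEnd L ⊎ γ ≡ legEnd R
    stop⇐       : ∀ {γ} → γ ≡ legEnd L ⊎ γ ≡ legEnd R → St γ

rowShape : ∀ {Ed St} a x₀ x₁ → x₀ ≢ x₁ → (L : Leg x₀ a) (R : Leg x₁ a) →
           (HasTail L → IsStop R) → (HasTail R → IsStop L) →
           (∀ {u v} → Ed u v → OnSegment (x₀ , a) (x₁ , a) u v ⊎ LegEdge L u v ⊎ LegEdge R u v) →
           (∀ {u v} → OnSegment (x₀ , a) (x₁ , a) u v ⊎ LegEdge L u v ⊎ LegEdge R u v → Ed u v) →
           (∀ {γ} → St γ → γ ≡ legEnd L ⊎ γ ≡ legEnd R) →
           (∀ {γ} → γ ≡ legEnd L ⊎ γ ≡ legEnd R → St γ) → RowShape Ed St a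
rowShape a x₀ x₁ x₀≢x₁ L R tL tR e⇒ e⇐ s⇒ s⇐ with ℤP.<-cmp x₀ x₁
... | tri< x₀<x₁ _ _ = record
  { α = x₀ ; β = x₁ ; α<β = x₀<x₁ ; L = L ; R = R ; tailᴸ⇒stopᴿ = tL ; tailᴿ⇒stopᴸ = tR
  ; edge⇒ = e⇒ ; edge⇐ = e⇐ ; stop⇒ = s⇒ ; stop⇐ = s⇐ }
... | tri≈ _ x₀≡x₁ _ = ⊥-elim (x₀≢x₁ x₀≡x₁)
... | tri> _ _ x₁<x₀ = record
  { α = x₁ ; β = x₀ ; α<β = x₁<x₀ ; L = R ; R = L ; tailᴸ⇒stopᴿ = tR ; tailᴿ⇒stopᴸ = tL
  ; edge⇒ = mirror ∘ e⇒ ; edge⇐ = e⇐ ∘ mirror ; stop⇒ = swap ∘ s⇒ ; stop⇐ = s⇐ ∘ swap }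
  where
  mirror : ∀ {y₀ y₁ A B u v} → OnSegment (y₀ , a) (y₁ , a) u v ⊎ A ⊎ B →
                               OnSegment (y₁ , a) (y₀ , a) u v ⊎ B ⊎ A
  mirror = map⊎ (onSegment-reverse _ _) swap

data Zigzag : List Point → Set where
  hor : ∀ {x₀ x₁ y} → x₀ ≢ x₁ → Zigzag ((x₀ , y) ∷ (x₁ , y) ∷ [])
  ver : ∀ {x y₀ y₁} → y₀ ≢ y₁ → Zigzag ((x , y₀) ∷ (x , y₁) ∷ [])
  hv  : ∀ {x₀ x₁ y₀ y₂} → x₀ ≢ x₁ → y₀ ≢ y₂ → Zigzag ((x₀ , y₀) ∷ (x₁ , y₀) ∷ (x₁ , y₂) ∷ [])
  vh  : ∀ {x₀ x₂ y₀ y₁} → y₀ ≢ y₁ → x₀ ≢ x₂ → Zigzag ((x₀ , y₀) ∷ (x₀ , y₁) ∷ (x₂ , y₁) ∷ [])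
  hvh : ∀ {x₀ x₁ x₃ y₀ y₂} → x₀ ≢ x₁ → y₀ ≢ y₂ → x₁ ≢ x₃ →
        Zigzag ((x₀ , y₀) ∷ (x₁ , y₀) ∷ (x₁ , y₂) ∷ (x₃ , y₂) ∷ [])
  vhv : ∀ {x₀ x₂ y₀ y₁ y₃} → y₀ ≢ y₁ → x₀ ≢ x₂ → y₁ ≢ y₃ →
        Zigzag ((x₀ , y₀) ∷ (x₀ , y₁) ∷ (x₂ , y₁) ∷ (x₂ , y₃) ∷ [])

-- isHoriz unfolds to these decisions, so the lemmas are stated about them directly
no-turn-hh : ∀ {y y′ : ℤ} → (does (y ℤ.≟ y) xor does (y′ ℤ.≟ y′)) ≢ true
no-turn-hh {y} {y′} t rewrite dec-true (y ℤ.≟ y) refl | dec-true (y′ ℤ.≟ y′) refl with t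
... | ()

no-turn-vv : ∀ {y₀ y₁ y₂ y₃ : ℤ} → y₀ ≢ y₁ → y₂ ≢ y₃ → (does (y₀ ℤ.≟ y₁) xor does (y₂ ℤ.≟ y₃)) ≢ true
no-turn-vv {y₀} {y₁} {y₂} {y₃} ne ne′ t
  rewrite dec-false (y₀ ℤ.≟ y₁) ne | dec-false (y₂ ℤ.≟ y₃) ne′ with t
... | ()

zigzag : ∀ p q vs → Alternating (p ∷ q ∷ vs) → length vs ℕ.≤ 2 → Zigzag (p ∷ q ∷ vs)
zigzag (x₀ , y₀) (x₁ , .y₀) [] (inj₁ (refl , ne)) _ = hor ne
zigzag (x₀ , y₀) (.x₀ , y₁) [] (inj₂ (refl , ne)) _ = ver ne
zigzag (x₀ , y₀) (x₁ , y₁) ((x₂ , y₂) ∷ []) (al₁ , t , al₂) _ with al₁ | al₂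
... | inj₁ (refl , ne₁) | inj₂ (refl , ne₂) = hv ne₁ ne₂
... | inj₂ (refl , ne₁) | inj₁ (refl , ne₂) = vh ne₁ ne₂
... | inj₁ (refl , _) | inj₁ (refl , _) = ⊥-elim (no-turn-hh {y₀} {y₀} t)
... | inj₂ (refl , ne₁) | inj₂ (refl , ne₂) =
  ⊥-elim (no-turn-vv ne₁ ne₂ t)
zigzag (x₀ , y₀) (x₁ , y₁) ((x₂ , y₂) ∷ (x₃ , y₃) ∷ []) (al₁ , t₁ , al₂ , t₂ , al₃) _
  with al₁ | al₂ | al₃
... | inj₁ (refl , ne₁) | inj₂ (refl , ne₂) | inj₁ (refl , ne₃) = hvh ne₁ ne₂ ne₃
... | inj₂ (refl , ne₁) | inj₁ (refl , ne₂) | inj₂ (refl , ne₃) = vhv ne₁ ne₂ ne₃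
... | inj₁ (refl , _) | inj₁ (refl , _) | _ = ⊥-elim (no-turn-hh {y₀} {y₀} t₁)
... | inj₂ (refl , ne₁) | inj₂ (refl , ne₂) | _ =
  ⊥-elim (no-turn-vv ne₁ ne₂ t₁)
... | inj₁ (refl , _) | inj₂ (refl , ne₂) | inj₂ (refl , ne₃) =
  ⊥-elim (no-turn-vv ne₂ ne₃ t₂)
... | inj₂ (refl , _) | inj₁ (refl , _) | inj₁ (refl , _) = ⊥-elim (no-turn-hh {y₁} {y₁} t₂)
zigzag _ _ (_ ∷ _ ∷ _ ∷ _) _ (ℕ.s≤s (ℕ.s≤s ()))

PolylineEnds : List Point → Point → Set
PolylineEnds (p ∷ q ∷ vs) γ = γ ≡ p ⊎ γ ≡ lastOf q vs
PolylineEnds _ γ = ⊥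

vertical-no-rowEdge : ∀ {x y₀ y₁ k a} → y₀ ≢ y₁ → ¬ OnSegment (x , y₀) (x , y₁) (k , a) (ℤ.suc k , a)
vertical-no-rowEdge y₀≢y₁ s with onSegment-hUnit s
... | e₀ , e₁ , _ = y₀≢y₁ (trans e₀ (sym e₁))

zigzag-rowShape : ∀ {ps} a → Zigzag ps → (∃[ k ] OnPolyline ps (k , a) (ℤ.suc k , a)) →
                  RowShape (OnPolyline ps) (PolylineEnds ps) a
zigzag-rowShape a (hor ne) (k , inj₁ s) with onSegment-hUnit s
... | refl , _ , _ = rowShape a _ _ ne stop stop (λ ()) (λ ())
  (λ { (inj₁ s) → inj₁ s })
  (λ { (inj₁ s) → inj₁ s ; (inj₂ (inj₁ ())) ; (inj₂ (inj₂ ())) })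
  id id
zigzag-rowShape a (ver ne) (k , inj₁ s) = ⊥-elim (vertical-no-rowEdge ne s)
zigzag-rowShape a (hv ne₁ ne₂) (k , inj₁ s) with onSegment-hUnit s
... | refl , _ , _ = rowShape a _ _ ne₁ stop (turn _ (≢-sym ne₂) noTail) (λ ()) (λ ())
  (λ { (inj₁ s) → inj₁ s ; (inj₂ (inj₁ s)) → inj₂ (inj₂ s) })
  (λ { (inj₁ s) → inj₁ s ; (inj₂ (inj₁ ())) ; (inj₂ (inj₂ s)) → inj₂ (inj₁ s) })
  id id
zigzag-rowShape a (hv ne₁ ne₂) (k , inj₂ (inj₁ s)) = ⊥-elim (vertical-no-rowEdge ne₂ s)
zigzag-rowShape a (vh ne₁ ne₂) (k , inj₁ s) = ⊥-elim (vertical-no-rowEdge ne₁ s)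
zigzag-rowShape a (vh ne₁ ne₂) (k , inj₂ (inj₁ s)) with onSegment-hUnit s
... | refl , _ , _ = rowShape a _ _ ne₂ (turn _ ne₁ noTail) stop (λ ()) (λ ())
  (λ { (inj₁ s) → inj₂ (inj₁ (onSegment-reverse _ _ s)) ; (inj₂ (inj₁ s)) → inj₁ s })
  (λ { (inj₁ s) → inj₂ (inj₁ s) ; (inj₂ (inj₁ s)) → inj₁ (onSegment-reverse _ _ s) ; (inj₂ (inj₂ ())) })
  id id
zigzag-rowShape a (hvh ne₁ ne₂ ne₃) (k , inj₁ s) with onSegment-hUnit s
... | refl , _ , _ = rowShape a _ _ ne₁ stop (turn _ (≢-sym ne₂) (tail _ (≢-sym ne₃))) (λ ()) _
  (λ { (inj₁ s) → inj₁ s ; (inj₂ (inj₁ s)) → inj₂ (inj₂ (inj₁ s))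
     ; (inj₂ (inj₂ (inj₁ s))) → inj₂ (inj₂ (inj₂ s)) })
  (λ { (inj₁ s) → inj₁ s ; (inj₂ (inj₁ ())) ; (inj₂ (inj₂ (inj₁ s))) → inj₂ (inj₁ s)
     ; (inj₂ (inj₂ (inj₂ s))) → inj₂ (inj₂ (inj₁ s)) })
  id id
zigzag-rowShape a (hvh ne₁ ne₂ ne₃) (k , inj₂ (inj₁ s)) = ⊥-elim (vertical-no-rowEdge ne₂ s)
zigzag-rowShape a (hvh ne₁ ne₂ ne₃) (k , inj₂ (inj₂ (inj₁ s))) with onSegment-hUnit s
... | refl , _ , _ = rowShape a _ _ ne₃ (turn _ ne₂ (tail _ ne₁)) stop _ (λ ())
  (λ { (inj₁ s) → inj₂ (inj₁ (inj₂ (onSegment-reverse _ _ s)))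
     ; (inj₂ (inj₁ s)) → inj₂ (inj₁ (inj₁ (onSegment-reverse _ _ s))) ; (inj₂ (inj₂ (inj₁ s))) → inj₁ s })
  (λ { (inj₁ s) → inj₂ (inj₂ (inj₁ s)) ; (inj₂ (inj₁ (inj₁ s))) → inj₂ (inj₁ (onSegment-reverse _ _ s))
     ; (inj₂ (inj₁ (inj₂ s))) → inj₁ (onSegment-reverse _ _ s) ; (inj₂ (inj₂ ())) })
  id id
zigzag-rowShape a (vhv ne₁ ne₂ ne₃) (k , inj₁ s) = ⊥-elim (vertical-no-rowEdge ne₁ s)
zigzag-rowShape a (vhv ne₁ ne₂ ne₃) (k , inj₂ (inj₁ s)) with onSegment-hUnit s
... | refl , _ , _ = rowShape a _ _ ne₂ (turn _ ne₁ noTail) (turn _ (≢-sym ne₃) noTail) (λ ()) (λ ())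
  (λ { (inj₁ s) → inj₂ (inj₁ (onSegment-reverse _ _ s)) ; (inj₂ (inj₁ s)) → inj₁ s
     ; (inj₂ (inj₂ (inj₁ s))) → inj₂ (inj₂ s) })
  (λ { (inj₁ s) → inj₂ (inj₁ s) ; (inj₂ (inj₁ s)) → inj₁ (onSegment-reverse _ _ s)
     ; (inj₂ (inj₂ s)) → inj₂ (inj₂ (inj₁ s)) })
  id id
zigzag-rowShape a (vhv ne₁ ne₂ ne₃) (k , inj₂ (inj₂ (inj₁ s))) = ⊥-elim (vertical-no-rowEdge ne₃ s)

rowShape-map : ∀ {Ed Ed′ : Point → Point → Set} {St St′ : Point → Set} {a} →
               (∀ {u v} → Ed′ u v → Ed u v) → (∀ {u v} → Ed u v → Ed′ u v) →
               (∀ {γ} → St′ γ → St γ) → (∀ {γ} → St γ → St′ γ) → RowShape Ed St a → RowShape Ed′ St′ a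
rowShape-map f g f′ g′ shape = record
  { α = α ; β = β ; α<β = α<β ; L = L ; R = R ; tailᴸ⇒stopᴿ = tailᴸ⇒stopᴿ ; tailᴿ⇒stopᴸ = tailᴿ⇒stopᴸ
  ; edge⇒ = edge⇒ ∘ f ; edge⇐ = g ∘ edge⇐ ; stop⇒ = stop⇒ ∘ f′ ; stop⇐ = g′ ∘ stop⇐ }
  where open RowShape shape

EndsAt : List Point → Point → Set
EndsAt xs γ = (∃[ rs ] xs ≡ γ ∷ rs) ⊎ (∃[ rs ] xs ≡ rs ∷ʳ γ)

∷ʳ⇒lastOf : ∀ p qs rs {γ} → p ∷ qs ≡ rs ∷ʳ γ → γ ≡ lastOf p qs
∷ʳ⇒lastOf p [] [] refl = refl
∷ʳ⇒lastOf p [] (_ ∷ []) ()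
∷ʳ⇒lastOf p [] (_ ∷ _ ∷ _) ()
∷ʳ⇒lastOf p (q ∷ qs) [] ()
∷ʳ⇒lastOf p (q ∷ qs) (r ∷ rs) e = ∷ʳ⇒lastOf q qs rs (∷-injectiveʳ e)

lastOf⇒∷ʳ : ∀ p qs → ∃[ rs ] (p ∷ qs ≡ rs ∷ʳ lastOf p qs)
lastOf⇒∷ʳ p [] = [] , refl
lastOf⇒∷ʳ p (q ∷ qs) with lastOf⇒∷ʳ q qs
... | rs , e = p ∷ rs , cong (p ∷_) e

simplePath-rowShape : ∀ a xs → Linked Step xs → Unique xs → 2 ℕ.≤ length xs → bendsL xs ℕ.≤ 2 →
                      (∃[ k ] EdgeOf xs (k , a) (ℤ.suc k , a)) → RowShape (EdgeOf xs) (EndsAt xs) a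
simplePath-rowShape a (_ ∷ []) _ _ (ℕ.s≤s ()) _ _
simplePath-rowShape a (p ∷ q ∷ qs) linked simple _ ≤2 (k , e) =
  rowShape-map D.edge⇒ D.edge⇐ ends⇒ ends⇐
    (zigzag-rowShape a (zigzag p D.next D.rest D.alternating (subst (ℕ._≤ 2) (sym D.length≡bends) ≤2))
                     (k , D.edge⇒ e))
  where
  module D = Straightened (straighten p q qs linked simple)
  ends⇒ : ∀ {γ} → EndsAt (p ∷ q ∷ qs) γ → PolylineEnds (p ∷ D.next ∷ D.rest) γ
  ends⇒ (inj₁ (_ , refl)) = inj₁ refl
  ends⇒ (inj₂ (rs , e)) = inj₂ (trans (∷ʳ⇒lastOf p (q ∷ qs) rs e) (sym D.last≡))
  ends⇐ : ∀ {γ} → PolylineEnds (p ∷ D.next ∷ D.rest) γ → EndsAt (p ∷ q ∷ qs) γ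
  ends⇐ (inj₁ refl) = inj₁ (q ∷ qs , refl)
  ends⇐ (inj₂ refl) rewrite D.last≡ = inj₂ (lastOf⇒∷ʳ p (q ∷ qs))

path-rowShape : ∀ (P : GridPath) a → bends P ℕ.≤ 2 → IntersectsRow P a → RowShape (EdgeIn P) (StopsAt P) a
path-rowShape P a = simplePath-rowShape a (pts P) (linked P) (simple P) (nontriv P)

-- the vertical unit edge from row r to row r + 1 lies on the z-side of row a
Toward : Ty → ℤ → ℤ → Set
Toward ∅ a r = ⊥
Toward ↑ a r = a ≤ r
Toward ↓ a r = ℤ.suc r ≤ a

direction : ℤ → ℤ → Ty
direction a y with a ℤP.<? y
... | yes _ = ↑
... | no _ = ↓

legType : ∀ {c a} → Leg c a → Ty
legType stop = ∅
legType {c} {a} (turn y _ _) = direction a y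

UnitEdge : Point → Point → Set
UnitEdge u v = (∃[ k ] ∃[ r ] HUnit k r u v) ⊎ (∃[ k ] ∃[ r ] VUnit k r u v)

record RowView (P : GridPath) (a : ℤ) : Set where
  field
    α β              : ℤ
    α<β              : α < β
    x y              : Ty
    extremityα       : Extremity P a α x
    extremityβ       : Extremity P a β y
    rowEdge⇒inside   : ∀ k → EdgeIn P (k , a) (ℤ.suc k , a) → α ≤ k × k < β
    inside⇒rowEdge   : ∀ k → α ≤ k → k < β → EdgeIn P (k , a) (ℤ.suc k , a)
    verticalEdge⇒end : ∀ k r → EdgeIn P (k , r) (k , ℤ.suc r) →
                       (k ≡ α × Toward x a r) ⊎ (k ≡ β × Toward y a r)
    extremity-unique : ∀ k z → Extremity P a k z → (k ≡ α × z ≡ x) ⊎ (k ≡ β × z ≡ y)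
    otherRow         : ∀ r → r ≢ a → IntersectsRow P r →
                       (x ≡ ∅ × y ≡ direction a r) ⊎ (y ≡ ∅ × x ≡ direction a r)
    unitEdge         : ∀ {u v} → EdgeIn P u v → UnitEdge u v

onSegment-unitEdge : ∀ p q {u v} → OnSegment p q u v → UnitEdge u v
onSegment-unitEdge (_ , py) q (inj₁ (_ , k , _ , h)) = inj₁ (k , py , h)
onSegment-unitEdge (px , _) q (inj₂ (_ , k , _ , h)) = inj₂ (px , k , h)

legEdge-unitEdge : ∀ {c a} (L : Leg c a) {u v} → LegEdge L u v → UnitEdge u v
legEdge-unitEdge (turn y _ noTail) s = onSegment-unitEdge _ _ s
legEdge-unitEdge (turn y _ (tail x _)) (inj₁ s) = onSegment-unitEdge _ _ s
legEdge-unitEdge (turn y _ (tail x _)) (inj₂ s) = onSegment-unitEdge _ _ s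

legEdge-notOnRow : ∀ {c a k} (L : Leg c a) → ¬ LegEdge L (k , a) (ℤ.suc k , a)
legEdge-notOnRow (turn y ne noTail) s = ne (proj₁ (proj₂ (onSegment-hUnit s)))
legEdge-notOnRow (turn y ne (tail x _)) (inj₁ s) = ne (proj₁ (proj₂ (onSegment-hUnit s)))
legEdge-notOnRow (turn y ne (tail x _)) (inj₂ s) = ne (proj₁ (onSegment-hUnit s))

toward-direction : ∀ {a y r} → y ≢ a → UnitBetween a y r → Toward (direction a y) a r
toward-direction {a} {y} ne b with a ℤP.<? y | b
... | yes _ | inj₁ (h , _) = h
... | yes a<y | inj₂ (h₁ , h₂) = ⊥-elim (ℤP.≤⇒≯ h₁ (ℤP.<-trans h₂ a<y))
... | no a≮y | inj₁ (h₁ , h₂) = ⊥-elim (a≮y (ℤP.≤-<-trans h₁ h₂))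
... | no _ | inj₂ (_ , h) = ℤP.i<j⇒suc[i]≤j h

legEdge-vertical : ∀ {c a k r} (L : Leg c a) → LegEdge L (k , r) (k , ℤ.suc r) → k ≡ c × Toward (legType L) a r
legEdge-vertical (turn y ne noTail) s with onSegment-vUnit s
... | e , _ , b = sym e , toward-direction ne b
legEdge-vertical (turn y ne (tail x _)) (inj₁ s) with onSegment-vUnit s
... | e , _ , b = sym e , toward-direction ne b
legEdge-vertical (turn y ne (tail x x≢c)) (inj₂ s) with onSegment-vUnit s
... | e₁ , e₂ , _ = ⊥-elim (x≢c (trans e₂ (sym e₁)))

legEdge-otherRow : ∀ {c a k r} (L : Leg c a) → r ≢ a → LegEdge L (k , r) (ℤ.suc k , r) →
                   HasTail L × legType L ≡ direction a r
legEdge-otherRow (turn y ne noTail) r≢a s = ⊥-elim (r≢a (sym (proj₁ (onSegment-hUnit s))))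
legEdge-otherRow (turn y ne (tail x _)) r≢a (inj₁ s) = ⊥-elim (r≢a (sym (proj₁ (onSegment-hUnit s))))
legEdge-otherRow (turn y ne (tail x _)) r≢a (inj₂ s) with onSegment-hUnit s
... | refl , _ = _ , refl

stop-legType : ∀ {c a} (L : Leg c a) → IsStop L → legType L ≡ ∅
stop-legType stop _ = refl

stop-legEnd : ∀ {c a} (L : Leg c a) → IsStop L → legEnd L ≡ (c , a)
stop-legEnd stop _ = refl

legEnd-onRow : ∀ {c a k} (L : Leg c a) → (k , a) ≡ legEnd L → k ≡ c × legType L ≡ ∅
legEnd-onRow stop e = proj₁ (point-injective e) , refl
legEnd-onRow (turn y ne noTail) e = ⊥-elim (ne (sym (proj₂ (point-injective e))))
legEnd-onRow (turn y ne (tail x _)) e = ⊥-elim (ne (sym (proj₂ (point-injective e))))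

leg-typeAt : ∀ (P : GridPath) {c a} (L : Leg c a) → (∀ {u v} → LegEdge L u v → EdgeIn P u v) →
             (IsStop L → StopsAt P (c , a)) → TypeAt P a c (legType L)
leg-typeAt P stop _ stops = stops _
leg-typeAt P {c} {a} (turn y ne tl) edge _ with a ℤP.<? y
... | yes a<y = edge (first tl)
  where
  up : OnSegment (c , a) (c , y) (c , a) (c , ℤ.suc a)
  up = inj₂ (refl , a , inj₁ (ℤP.≤-refl , a<y) , inj₁ (refl , refl))
  first : ∀ tl → LegEdge (turn y ne tl) (c , a) (c , ℤ.suc a)
  first noTail = up
  first (tail _ _) = inj₁ up
... | no a≮y = edge (first tl)
  where
  down : OnSegment (c , a) (c , y) (c , a) (c , ℤ.pred a)
  down = inj₂ (refl , ℤ.pred a , inj₂ (ℤP.i<j⇒i≤pred[j] (ℤP.≤∧≢⇒< (ℤP.≮⇒≥ a≮y) ne) , pred[i]<i a) ,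
               inj₂ (cong (c ,_) (sym (ℤP.suc-pred a)) , refl))
  first : ∀ tl → LegEdge (turn y ne tl) (c , a) (c , ℤ.pred a)
  first noTail = down
  first (tail _ _) = inj₁ down

toward-below : ∀ {z a} → Toward z a (ℤ.pred a) → z ≡ ↓
toward-below {↓} _ = refl
toward-below {↑} {a} h = ⊥-elim (ℤP.≤⇒≯ h (pred[i]<i a))

toward-above : ∀ {z a} → Toward z a a → z ≡ ↑
toward-above {↑} _ = refl
toward-above {↓} {a} h = ⊥-elim (ℤP.<-irrefl refl (ℤP.suc[i]≤j⇒i<j h))

rowShape-rowView : ∀ (P : GridPath) a → RowShape (EdgeIn P) (StopsAt P) a → RowView P a
rowShape-rowView P a shape = record
  { α = α ; β = β ; α<β = α<β ; x = legType L ; y = legType R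
  ; extremityα = inj₂ (edge⇐ (inj₁ firstEdge)) ,
                 leg-typeAt P L (edge⇐ ∘ inj₂ ∘ inj₁) (λ s → stop⇐ (inj₁ (sym (stop-legEnd L s))))
  ; extremityβ = inj₁ (edge⇐ (inj₁ lastEdge)) ,
                 leg-typeAt P R (edge⇐ ∘ inj₂ ∘ inj₂) (λ s → stop⇐ (inj₂ (sym (stop-legEnd R s))))
  ; rowEdge⇒inside = rowEdge⇒inside
  ; inside⇒rowEdge = λ k α≤k k<β → edge⇐ (inj₁ (inj₁ (refl , k , inj₁ (α≤k , k<β) , inj₁ (refl , refl))))
  ; verticalEdge⇒end = verticalEdge⇒end ; extremity-unique = extremity-unique
  ; otherRow = otherRow ; unitEdge = unitEdge }
  where
  open RowShape shape
  firstEdge : OnSegment (α , a) (β , a) (α , a) (ℤ.suc α , a)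
  firstEdge = inj₁ (refl , α , inj₁ (ℤP.≤-refl , α<β) , inj₁ (refl , refl))
  lastEdge : OnSegment (α , a) (β , a) (ℤ.pred β , a) (β , a)
  lastEdge = inj₁ (refl , ℤ.pred β , inj₁ (ℤP.i<j⇒i≤pred[j] α<β , pred[i]<i β) ,
                   inj₁ (refl , cong (_, a) (sym (ℤP.suc-pred β))))
  rowEdge⇒inside : ∀ k → EdgeIn P (k , a) (ℤ.suc k , a) → α ≤ k × k < β
  rowEdge⇒inside k e with edge⇒ e
  ... | inj₂ (inj₁ s) = ⊥-elim (legEdge-notOnRow L s)
  ... | inj₂ (inj₂ s) = ⊥-elim (legEdge-notOnRow R s)
  ... | inj₁ s with onSegment-hUnit s
  ...   | _ , _ , inj₁ h = h
  ...   | _ , _ , inj₂ (h₁ , h₂) = ⊥-elim (ℤP.≤⇒≯ h₁ (ℤP.<-trans h₂ α<β))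
  verticalEdge⇒end : ∀ k r → EdgeIn P (k , r) (k , ℤ.suc r) →
                     (k ≡ α × Toward (legType L) a r) ⊎ (k ≡ β × Toward (legType R) a r)
  verticalEdge⇒end k r e with edge⇒ e
  ... | inj₁ s = ⊥-elim (ℤP.<-irrefl (trans e₁ (sym e₂)) α<β)
    where e₁ = proj₁ (onSegment-vUnit s) ; e₂ = proj₁ (proj₂ (onSegment-vUnit s))
  ... | inj₂ (inj₁ s) = inj₁ (legEdge-vertical L s)
  ... | inj₂ (inj₂ s) = inj₂ (legEdge-vertical R s)
  extremity-unique : ∀ k z → Extremity P a k z → (k ≡ α × z ≡ legType L) ⊎ (k ≡ β × z ≡ legType R)
  extremity-unique k ∅ (_ , st) with stop⇒ st
  ... | inj₁ e = inj₁ (map× id sym (legEnd-onRow L e))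
  ... | inj₂ e = inj₂ (map× id sym (legEnd-onRow R e))
  extremity-unique k ↓ (_ , e)
    with verticalEdge⇒end k (ℤ.pred a) (subst (λ z → EdgeIn P (k , ℤ.pred a) (k , z)) (sym (ℤP.suc-pred a)) (swap e))
  ... | inj₁ (e₁ , t) = inj₁ (e₁ , sym (toward-below t))
  ... | inj₂ (e₁ , t) = inj₂ (e₁ , sym (toward-below t))
  extremity-unique k ↑ (_ , e) with verticalEdge⇒end k a e
  ... | inj₁ (e₁ , t) = inj₁ (e₁ , sym (toward-above t))
  ... | inj₂ (e₁ , t) = inj₂ (e₁ , sym (toward-above t))
  otherRow : ∀ r → r ≢ a → IntersectsRow P r →
             (legType L ≡ ∅ × legType R ≡ direction a r) ⊎ (legType R ≡ ∅ × legType L ≡ direction a r)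
  otherRow r r≢a (k , e) with edge⇒ e
  ... | inj₁ s = ⊥-elim (r≢a (sym (proj₁ (onSegment-hUnit s))))
  ... | inj₂ (inj₁ s) = inj₂ (stop-legType R (tailᴸ⇒stopᴿ (proj₁ (legEdge-otherRow L r≢a s))) ,
                              proj₂ (legEdge-otherRow L r≢a s))
  ... | inj₂ (inj₂ s) = inj₁ (stop-legType L (tailᴿ⇒stopᴸ (proj₁ (legEdge-otherRow R r≢a s))) ,
                              proj₂ (legEdge-otherRow R r≢a s))
  unitEdge : ∀ {u v} → EdgeIn P u v → UnitEdge u v
  unitEdge e with edge⇒ e
  ... | inj₁ s = onSegment-unitEdge _ _ s
  ... | inj₂ (inj₁ s) = legEdge-unitEdge L s
  ... | inj₂ (inj₂ s) = legEdge-unitEdge R s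

rowView : ∀ (P : GridPath) a → bends P ℕ.≤ 2 → IntersectsRow P a → RowView P a
rowView P a ≤2 i = rowShape-rowView P a (path-rowShape P a ≤2 i)

tproj : ∀ {P a} → RowView P a → TInterval
tproj V = ⟦ RowView.x V , RowView.α V , RowView.y V , RowView.β V ⟧

tproj-isTProj : ∀ {P a} (V : RowView P a) → TProj P a (tproj V)
tproj-isTProj V = RowView.α<β V , RowView.extremityα V , RowView.extremityβ V

tProj-unique : ∀ {P a} (V : RowView P a) {t} → TProj P a t → t ≡ tproj V
tProj-unique V {⟦ _ , _ , _ , _ ⟧} (l<r , el , er)
  with RowView.extremity-unique V _ _ el | RowView.extremity-unique V _ _ er
... | inj₁ (refl , refl) | inj₂ (refl , refl) = refl
... | inj₁ (refl , _) | inj₁ (refl , _) = ⊥-elim (ℤP.<-irrefl refl l<r)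
... | inj₂ (refl , _) | inj₂ (refl , _) = ⊥-elim (ℤP.<-irrefl refl l<r)
... | inj₂ (refl , _) | inj₁ (refl , _) = ⊥-elim (ℤP.<-asym l<r (RowView.α<β V))

-- Sharing a grid edge, read off the t-projections

Meet : TInterval → TInterval → Set
Meet t t′ = (∃[ k ] (lpt t ≤ k × k < rpt t × lpt t′ ≤ k × k < rpt t′)) ⊎
            (∃[ z ] ∃[ γ ] (z ≢ ∅ × IsEndpointOf z γ t × IsEndpointOf z γ t′))

meet⇒intersects : ∀ {t t′} → Meet t t′ → Intersects t t′
meet⇒intersects (inj₁ (k , h₁ , h₂ , h₃ , h₄)) = inj₁ (k , h₁ , ℤP.i<j⇒suc[i]≤j h₂ , h₃ , ℤP.i<j⇒suc[i]≤j h₄)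
meet⇒intersects (inj₂ (_ , _ , ne , ep , inj₁ (refl , refl))) = inj₂ (inj₁ (inj₂ (inj₂ (ne , ep))))
meet⇒intersects (inj₂ (_ , _ , ne , ep , inj₂ (refl , refl))) = inj₂ (inj₂ (inj₁ (inj₂ (inj₂ (ne , ep)))))

¬meet⇒separated : ∀ t t′ → lpt t < rpt t → lpt t′ < rpt t′ → ¬ Meet t t′ →
                  rpt t ≤ lpt t′ ⊎ rpt t′ ≤ lpt t
¬meet⇒separated t t′ l<r l<r′ ¬meet with rpt t ℤP.≤? lpt t′ | rpt t′ ℤP.≤? lpt t
... | yes h | _ = inj₁ h
... | no _ | yes h = inj₂ h
... | no h₁ | no h₂ with ℤP.≤-total (lpt t) (lpt t′)
...   | inj₁ h = ⊥-elim (¬meet (inj₁ (lpt t′ , h , ℤP.≰⇒> h₁ , ℤP.≤-refl , l<r′)))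
...   | inj₂ h = ⊥-elim (¬meet (inj₁ (lpt t , ℤP.≤-refl , l<r , h , ℤP.≰⇒> h₂)))

toward-unique : ∀ {z z′ a r} → Toward z a r → Toward z′ a r → z ≡ z′
toward-unique {↓} {↓} _ _ = refl
toward-unique {↑} {↑} _ _ = refl
toward-unique {↓} {↑} h₁ h₂ = ⊥-elim (ℤP.<-irrefl refl (ℤP.<-≤-trans (ℤP.suc[i]≤j⇒i<j h₁) h₂))
toward-unique {↑} {↓} h₁ h₂ = ⊥-elim (ℤP.<-irrefl refl (ℤP.<-≤-trans (ℤP.suc[i]≤j⇒i<j h₂) h₁))

toward⇒≢∅ : ∀ {z a r} → Toward z a r → z ≢ ∅
toward⇒≢∅ {↓} _ ()
toward⇒≢∅ {↑} _ ()

verticalEdge⇒endpoint : ∀ {P a} (V : RowView P a) {k r} → EdgeIn P (k , r) (k , ℤ.suc r) →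
                        ∃[ z ] (Toward z a r × IsEndpointOf z k (tproj V))
verticalEdge⇒endpoint V {k} {r} e with RowView.verticalEdge⇒end V k r e
... | inj₁ (refl , t) = _ , t , inj₁ (refl , refl)
... | inj₂ (refl , t) = _ , t , inj₂ (refl , refl)

endpoint-typeAt : ∀ {P a z γ} (V : RowView P a) → IsEndpointOf z γ (tproj V) → TypeAt P a γ z
endpoint-typeAt V (inj₁ (refl , refl)) = proj₂ (RowView.extremityα V)
endpoint-typeAt V (inj₂ (refl , refl)) = proj₂ (RowView.extremityβ V)

shareEdge⇒meet : ∀ {P Q a} (VP : RowView P a) (VQ : RowView Q a) →
                 (∀ r → IntersectsRow P r → IntersectsRow Q r → r ≡ a) →
                 ShareEdge P Q → Meet (tproj VP) (tproj VQ)
shareEdge⇒meet {P} {Q} {a} VP VQ onlyRow (u , v , eP , eQ) = meet (RowView.unitEdge VP eP) eP eQ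
  where
  horizontal-meet : ∀ k {r} → EdgeIn P (k , r) (ℤ.suc k , r) → EdgeIn Q (k , r) (ℤ.suc k , r) →
                    Meet (tproj VP) (tproj VQ)
  horizontal-meet k {r} eP eQ with onlyRow r (k , eP) (k , eQ)
  ... | refl with RowView.rowEdge⇒inside VP k eP | RowView.rowEdge⇒inside VQ k eQ
  ...   | h₁ , h₂ | h₃ , h₄ = inj₁ (k , h₁ , h₂ , h₃ , h₄)
  vertical-meet : ∀ {k r} → EdgeIn P (k , r) (k , ℤ.suc r) → EdgeIn Q (k , r) (k , ℤ.suc r) →
                  Meet (tproj VP) (tproj VQ)
  vertical-meet eP eQ with verticalEdge⇒endpoint VP eP | verticalEdge⇒endpoint VQ eQ
  ... | z , t , ep | z′ , t′ , ep′ rewrite toward-unique t′ t = inj₂ (z , _ , toward⇒≢∅ t , ep , ep′)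
  meet : ∀ {u v} → UnitEdge u v → EdgeIn P u v → EdgeIn Q u v → Meet (tproj VP) (tproj VQ)
  meet (inj₁ (k , r , inj₁ (refl , refl))) eP eQ = horizontal-meet k eP eQ
  meet (inj₁ (k , r , inj₂ (refl , refl))) eP eQ = horizontal-meet k (swap eP) (swap eQ)
  meet (inj₂ (k , r , inj₁ (refl , refl))) eP eQ = vertical-meet eP eQ
  meet (inj₂ (k , r , inj₂ (refl , refl))) eP eQ = vertical-meet (swap eP) (swap eQ)

meet⇒shareEdge : ∀ {P Q a} (VP : RowView P a) (VQ : RowView Q a) → Meet (tproj VP) (tproj VQ) → ShareEdge P Q
meet⇒shareEdge {a = a} VP VQ (inj₁ (k , h₁ , h₂ , h₃ , h₄)) =
  (k , a) , (ℤ.suc k , a) , RowView.inside⇒rowEdge VP k h₁ h₂ , RowView.inside⇒rowEdge VQ k h₃ h₄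
meet⇒shareEdge VP VQ (inj₂ (∅ , _ , ne , _)) = ⊥-elim (ne refl)
meet⇒shareEdge {a = a} VP VQ (inj₂ (↓ , γ , _ , ep , ep′)) =
  (γ , a) , (γ , ℤ.pred a) , endpoint-typeAt VP ep , endpoint-typeAt VQ ep′
meet⇒shareEdge {a = a} VP VQ (inj₂ (↑ , γ , _ , ep , ep′)) =
  (γ , a) , (γ , ℤ.suc a) , endpoint-typeAt VP ep , endpoint-typeAt VQ ep′

-- A separating typed interval for a finite family of intervals

EndTypes : Ty → TInterval → Set
EndTypes d s = (lty s ≡ ∅ ⊎ lty s ≡ d) × (rty s ≡ ∅ ⊎ rty s ≡ d)

_≟ᵀ_ : (z z′ : Ty) → Dec (z ≡ z′)
∅ ≟ᵀ ∅ = yes refl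
↓ ≟ᵀ ↓ = yes refl
↑ ≟ᵀ ↑ = yes refl
∅ ≟ᵀ ↓ = no (λ ())
∅ ≟ᵀ ↑ = no (λ ())
↓ ≟ᵀ ∅ = no (λ ())
↓ ≟ᵀ ↑ = no (λ ())
↑ ≟ᵀ ∅ = no (λ ())
↑ ≟ᵀ ↓ = no (λ ())

meet⇒left-end : ∀ u s → lpt u < rpt u → lpt s < rpt s → Meet u s →
                lpt u < rpt s ⊎ (lpt u ≡ rpt s × lty u ≢ ∅ × lty u ≡ rty s)
meet⇒left-end u s _ _ (inj₁ (k , h₁ , _ , _ , h₄)) = inj₁ (ℤP.≤-<-trans h₁ h₄)
meet⇒left-end u s _ s< (inj₂ (_ , _ , _ , inj₁ (refl , refl) , inj₁ (_ , refl))) = inj₁ s<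
meet⇒left-end u s _ _ (inj₂ (_ , _ , ne , inj₁ (refl , refl) , inj₂ (e , refl))) = inj₂ (refl , ne , e)
meet⇒left-end u s u< s< (inj₂ (_ , _ , _ , inj₂ (refl , refl) , inj₁ (_ , refl))) = inj₁ (ℤP.<-trans u< s<)
meet⇒left-end u s u< _ (inj₂ (_ , _ , _ , inj₂ (refl , refl) , inj₂ (_ , refl))) = inj₁ u<

meet⇒right-end : ∀ u s → lpt u < rpt u → lpt s < rpt s → Meet u s →
                 lpt s < rpt u ⊎ (rpt u ≡ lpt s × rty u ≢ ∅ × rty u ≡ lty s)
meet⇒right-end u s _ _ (inj₁ (k , _ , h₂ , h₃ , _)) = inj₁ (ℤP.≤-<-trans h₃ h₂)
meet⇒right-end u s u< _ (inj₂ (_ , _ , _ , inj₁ (refl , refl) , inj₁ (_ , refl))) = inj₁ u<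
meet⇒right-end u s u< s< (inj₂ (_ , _ , _ , inj₁ (refl , refl) , inj₂ (_ , refl))) = inj₁ (ℤP.<-trans s< u<)
meet⇒right-end u s _ _ (inj₂ (_ , _ , ne , inj₂ (refl , refl) , inj₁ (e , refl))) = inj₂ (refl , ne , e)
meet⇒right-end u s _ s< (inj₂ (_ , _ , _ , inj₂ (refl , refl) , inj₂ (_ , refl))) = inj₁ s<

<⇒proper : ∀ {t} → lpt t < rpt t → Proper t
<⇒proper h = ℤP.<⇒≤ h , inj₁ (ℤP.<⇒≢ h)

module Separator (d : Ty) (ts : List TInterval)
  (nondegenerate : ∀ {s} → s ∈ₗ ts → lpt s < rpt s) (typed : ∀ {s} → s ∈ₗ ts → EndTypes d s)
  {s₀ s₁ : TInterval} (s₀∈ts : s₀ ∈ₗ ts) (s₁∈ts : s₁ ∈ₗ ts) (¬meet : ¬ Meet s₀ s₁) where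

  sₘᵢₙ sₘₐₓ : TInterval
  sₘᵢₙ = argmin rpt s₀ ts
  sₘₐₓ = argmax lpt s₀ ts

  m M : ℤ
  m = rpt sₘᵢₙ
  M = lpt sₘₐₓ

  sₘᵢₙ∈ts : sₘᵢₙ ∈ₗ ts
  sₘᵢₙ∈ts = argmin-all rpt s₀∈ts (All.tabulate id)

  sₘₐₓ∈ts : sₘₐₓ ∈ₗ ts
  sₘₐₓ∈ts = argmax-all lpt s₀∈ts (All.tabulate id)

  m≤rpt : ∀ {s} → s ∈ₗ ts → m ≤ rpt s
  m≤rpt = All.lookup (f[argmin]≤f[xs] s₀ ts)

  lpt≤M : ∀ {s} → s ∈ₗ ts → lpt s ≤ M
  lpt≤M = All.lookup (f[xs]≤f[argmax] s₀ ts)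

  m≤M : m ≤ M
  m≤M with ¬meet⇒separated s₀ s₁ (nondegenerate s₀∈ts) (nondegenerate s₁∈ts) ¬meet
  ... | inj₁ h = ℤP.≤-trans (m≤rpt s₀∈ts) (ℤP.≤-trans h (lpt≤M s₁∈ts))
  ... | inj₂ h = ℤP.≤-trans (m≤rpt s₁∈ts) (ℤP.≤-trans h (lpt≤M s₀∈ts))

  zL zR : Ty
  zL = rty sₘᵢₙ
  zR = lty sₘₐₓ

  zL≡zR : zL ≢ ∅ → zR ≢ ∅ → zL ≡ zR
  zL≡zR zL≢∅ zR≢∅ with proj₂ (typed sₘᵢₙ∈ts) | proj₁ (typed sₘₐₓ∈ts)
  ... | inj₁ e | _ = ⊥-elim (zL≢∅ e)
  ... | inj₂ _ | inj₁ e = ⊥-elim (zR≢∅ e)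
  ... | inj₂ e₁ | inj₂ e₂ = trans e₁ (sym e₂)

  TypedL TypedR : Set
  TypedL = zL ≢ ∅ × (∀ {s} → s ∈ₗ ts → rpt s ≡ m → rty s ≡ zL)
  TypedR = zR ≢ ∅ × (∀ {s} → s ∈ₗ ts → lpt s ≡ M → lty s ≡ zR)

  typedL? : Dec TypedL
  typedL? with zL ≟ᵀ ∅ | All.all? (λ s → (rpt s ℤ.≟ m) →-dec (rty s ≟ᵀ zL)) ts
  ... | yes e | _ = no (λ tL → proj₁ tL e)
  ... | no ne | yes all = yes (ne , All.lookup all)
  ... | no _ | no ¬all = no (λ tL → ¬all (All.tabulate (proj₂ tL)))

  typedR? : Dec TypedR
  typedR? with zR ≟ᵀ ∅ | All.all? (λ s → (lpt s ℤ.≟ M) →-dec (lty s ≟ᵀ zR)) ts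
  ... | yes e | _ = no (λ tR → proj₁ tR e)
  ... | no ne | yes all = yes (ne , All.lookup all)
  ... | no _ | no ¬all = no (λ tR → ¬all (All.tabulate (proj₂ tR)))

  -- an untyped end is moved one unit outwards, so that it still covers the edge next to m (or M)
  leftType : Dec TypedL → Ty
  leftType (yes _) = zL
  leftType (no _) = ∅

  rightType : Dec TypedR → Ty
  rightType (yes _) = zR
  rightType (no _) = ∅

  leftPt : Dec TypedL → ℤ
  leftPt (yes _) = m
  leftPt (no _) = ℤ.pred m

  rightPt : Dec TypedR → ℤ
  rightPt (yes _) = M
  rightPt (no _) = ℤ.suc M

  separatorFor : Dec TypedL → Dec TypedR → TInterval
  separatorFor dL dR = ⟦ leftType dL , leftPt dL , rightType dR , rightPt dR ⟧

  leftPt≤m : ∀ dL → leftPt dL ≤ m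
  leftPt≤m (yes _) = ℤP.≤-refl
  leftPt≤m (no _) = ℤP.<⇒≤ (pred[i]<i m)

  M≤rightPt : ∀ dR → M ≤ rightPt dR
  M≤rightPt (yes _) = ℤP.≤-refl
  M≤rightPt (no _) = ℤP.<⇒≤ (i<suc[i] M)

  separatorFor-proper : ∀ dL dR → Proper (separatorFor dL dR)
  separatorFor-proper (yes tL) (yes tR) with ℤP.<-cmp m M
  ... | tri< m<M _ _ = <⇒proper m<M
  ... | tri≈ _ m≡M _ = m≤M , inj₂ (m≡M , zL≡zR (proj₁ tL) (proj₁ tR) , proj₁ tL)
  ... | tri> _ _ M<m = ⊥-elim (ℤP.≤⇒≯ m≤M M<m)
  separatorFor-proper (yes _) (no _) = <⇒proper (i≤j⇒i<suc[j] m≤M)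
  separatorFor-proper (no _) (yes _) = <⇒proper (ℤP.<-≤-trans (pred[i]<i m) m≤M)
  separatorFor-proper (no _) (no _) = <⇒proper (ℤP.<-trans (pred[i]<i m) (i≤j⇒i<suc[j] m≤M))

  intersects-separatorFor : ∀ dL dR {s} → s ∈ₗ ts → Intersects s (separatorFor dL dR)
  intersects-separatorFor dL dR {s} s∈ts with leftPt dL ℤP.<? rpt s | lpt s ℤP.<? rightPt dR
  ... | yes h₁ | yes h₂ with lpt s ℤP.<? leftPt dL
  ...   | yes h₃ = inj₂ (inj₁ (inj₁ (h₃ , h₁)))
  ...   | no h₃ = inj₁ (lpt s , ℤP.≤-refl , ℤP.i<j⇒suc[i]≤j (nondegenerate s∈ts) , ℤP.≮⇒≥ h₃ ,
                        ℤP.i<j⇒suc[i]≤j h₂)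
  intersects-separatorFor (yes (zL≢∅ , endsL)) dR {s} s∈ts | no h₁ | _ =
    inj₂ (inj₂ (inj₂ (inj₂ (inj₂ (inj₂ ((λ e → zL≢∅ (trans (sym (endsL s∈ts rpt≡m)) e)) ,
                                         inj₁ (endsL s∈ts rpt≡m , rpt≡m)))))))
    where
    rpt≡m : rpt s ≡ m
    rpt≡m = ℤP.≤-antisym (ℤP.≮⇒≥ h₁) (m≤rpt s∈ts)
  intersects-separatorFor (no _) dR s∈ts | no h₁ | _ =
    ⊥-elim (ℤP.≤⇒≯ (m≤rpt s∈ts) (ℤP.≤-<-trans (ℤP.≮⇒≥ h₁) (pred[i]<i m)))
  intersects-separatorFor dL (yes (zR≢∅ , endsR)) {s} s∈ts | yes _ | no h₂ =
    inj₂ (inj₂ (inj₂ (inj₁ (inj₂ (inj₂ ((λ e → zR≢∅ (trans (sym (endsR s∈ts lpt≡M)) e)) ,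
                                         inj₂ (endsR s∈ts lpt≡M , lpt≡M)))))))
    where
    lpt≡M : lpt s ≡ M
    lpt≡M = ℤP.≤-antisym (lpt≤M s∈ts) (ℤP.≮⇒≥ h₂)
  intersects-separatorFor dL (no _) s∈ts | yes _ | no h₂ =
    ⊥-elim (ℤP.≤⇒≯ (lpt≤M s∈ts) (ℤP.<-≤-trans (i<suc[i] M) (ℤP.≮⇒≥ h₂)))

  module _ (u : TInterval) (u-nondeg : lpt u < rpt u) (meets : ∀ {s} → s ∈ₗ ts → Meet u s) where

    lpt<m⊎typed : lpt u < m ⊎ (lpt u ≡ m × lty u ≢ ∅ × lty u ≡ zL)
    lpt<m⊎typed = meet⇒left-end u sₘᵢₙ u-nondeg (nondegenerate sₘᵢₙ∈ts) (meets sₘᵢₙ∈ts)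

    M<rpt⊎typed : M < rpt u ⊎ (rpt u ≡ M × rty u ≢ ∅ × rty u ≡ zR)
    M<rpt⊎typed = meet⇒right-end u sₘₐₓ u-nondeg (nondegenerate sₘₐₓ∈ts) (meets sₘₐₓ∈ts)

    lpt≤m : lpt u ≤ m
    lpt≤m = [ ℤP.<⇒≤ , ℤP.≤-reflexive ∘ proj₁ ] lpt<m⊎typed

    M≤rpt : M ≤ rpt u
    M≤rpt = [ ℤP.<⇒≤ , ℤP.≤-reflexive ∘ sym ∘ proj₁ ] M<rpt⊎typed

    typedL-from : lpt u ≡ m → lty u ≢ ∅ → lty u ≡ zL → TypedL
    typedL-from lpt≡m ne e = (λ z → ne (trans e z)) , ends
      where
      ends : ∀ {s} → s ∈ₗ ts → rpt s ≡ m → rty s ≡ zL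
      ends s∈ts rpt≡m with meet⇒left-end u _ u-nondeg (nondegenerate s∈ts) (meets s∈ts)
      ... | inj₁ lpt<rpt = ⊥-elim (ℤP.<-irrefl (trans lpt≡m (sym rpt≡m)) lpt<rpt)
      ... | inj₂ (_ , _ , e′) = trans (sym e′) e

    typedR-from : rpt u ≡ M → rty u ≢ ∅ → rty u ≡ zR → TypedR
    typedR-from rpt≡M ne e = (λ z → ne (trans e z)) , ends
      where
      ends : ∀ {s} → s ∈ₗ ts → lpt s ≡ M → lty s ≡ zR
      ends s∈ts lpt≡M with meet⇒right-end u _ u-nondeg (nondegenerate s∈ts) (meets s∈ts)
      ... | inj₁ lpt<rpt = ⊥-elim (ℤP.<-irrefl (trans lpt≡M (sym rpt≡M)) lpt<rpt)
      ... | inj₂ (_ , _ , e′) = trans (sym e′) e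

    lpt<m : ¬ TypedL → lpt u < m
    lpt<m ¬tL = [ id , (λ (e , ne , e′) → ⊥-elim (¬tL (typedL-from e ne e′))) ] lpt<m⊎typed

    M<rpt : ¬ TypedR → M < rpt u
    M<rpt ¬tR = [ id , (λ (e , ne , e′) → ⊥-elim (¬tR (typedR-from e ne e′))) ] M<rpt⊎typed

    cohL : ∀ dL dR → CohL u (separatorFor dL dR)
    cohL (yes tL) dR with lpt<m⊎typed
    ... | inj₂ (e , _ , e′) = inj₂ (inj₂ (proj₁ tL , inj₁ (sym e′ , sym e)))
    ... | inj₁ lpt<m′ with m ℤP.<? rpt u
    ...   | yes m<rpt = inj₁ (lpt<m′ , m<rpt)
    ...   | no m≮rpt with M<rpt⊎typed
    ...     | inj₁ M<rpt′ = ⊥-elim (m≮rpt (ℤP.≤-<-trans m≤M M<rpt′))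
    ...     | inj₂ (rpt≡M , ne , e) =
      inj₂ (inj₂ (proj₁ tL , inj₂ (trans (zL≡zR (proj₁ tL) (λ z → ne (trans e z))) (sym e) ,
                                   ℤP.≤-antisym (subst (m ≤_) (sym rpt≡M) m≤M) (ℤP.≮⇒≥ m≮rpt))))
    cohL (no ¬tL) dR = inj₂ (inj₁ (refl , ℤP.<-≤-trans (pred[i]<i m) (ℤP.≤-trans m≤M (M≤rightPt dR)) ,
                                   ℤP.i<j⇒i≤pred[j] (lpt<m ¬tL) ,
                                   subst (_≤ rpt u) (sym (ℤP.suc-pred m)) (ℤP.≤-trans m≤M M≤rpt)))

    cohR : ∀ dL dR → CohR u (separatorFor dL dR)
    cohR dL (yes tR) with M<rpt⊎typed
    ... | inj₂ (e , _ , e′) = inj₂ (inj₂ (proj₁ tR , inj₂ (sym e′ , sym e)))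
    ... | inj₁ M<rpt′ with lpt u ℤP.<? M
    ...   | yes lpt<M = inj₁ (lpt<M , M<rpt′)
    ...   | no lpt≮M with lpt<m⊎typed
    ...     | inj₁ lpt<m′ = ⊥-elim (lpt≮M (ℤP.<-≤-trans lpt<m′ m≤M))
    ...     | inj₂ (lpt≡m , ne , e) =
      inj₂ (inj₂ (proj₁ tR , inj₁ (trans (sym (zL≡zR (λ z → ne (trans e z)) (proj₁ tR))) (sym e) ,
                                   ℤP.≤-antisym (ℤP.≮⇒≥ lpt≮M) (subst (_≤ M) (sym lpt≡m) m≤M))))
    cohR dL (no ¬tR) = inj₂ (inj₁ (refl , i≤j⇒i<suc[j] (ℤP.≤-trans (leftPt≤m dL) m≤M) ,
                                   subst (lpt u ≤_) (sym (ℤP.pred-suc M)) (ℤP.≤-trans lpt≤m m≤M) ,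
                                   ℤP.i<j⇒suc[i]≤j (M<rpt ¬tR)))

    meets-all⇒contains : ∀ dL dR → Contains u (separatorFor dL dR)
    meets-all⇒contains dL dR = left dL , right dR , cohL dL dR , cohR dL dR
      where
      left : ∀ dL → lpt u ≤ leftPt dL
      left (yes _) = lpt≤m
      left (no ¬tL) = ℤP.i<j⇒i≤pred[j] (lpt<m ¬tL)
      right : ∀ dR → rightPt dR ≤ rpt u
      right (yes _) = M≤rpt
      right (no ¬tR) = ℤP.i<j⇒suc[i]≤j (M<rpt ¬tR)

  module _ (u : TInterval) (u-nondeg : lpt u < rpt u) where

    contained-left : ∀ {dR} dL → lpt u ≤ leftPt dL → CohL u (separatorFor dL dR) →
                     lpt u < m ⊎ (lpt u ≡ m × TypedL × lty u ≡ zL)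
    contained-left (yes tL) _ (inj₁ (lpt<m , _)) = inj₁ lpt<m
    contained-left (yes tL) _ (inj₂ (inj₁ (e , _))) = ⊥-elim (proj₁ tL e)
    contained-left (yes tL) _ (inj₂ (inj₂ (_ , inj₁ (e₁ , e₂)))) = inj₂ (sym e₂ , tL , sym e₁)
    contained-left (yes tL) _ (inj₂ (inj₂ (_ , inj₂ (_ , e)))) = inj₁ (subst (lpt u <_) (sym e) u-nondeg)
    contained-left (no _) ≤pred[m] _ = inj₁ (ℤP.i≤pred[j]⇒i<j ≤pred[m])

    contained-right : ∀ {dL} dR → rightPt dR ≤ rpt u → CohR u (separatorFor dL dR) →
                      M < rpt u ⊎ (rpt u ≡ M × TypedR × rty u ≡ zR)
    contained-right (yes tR) _ (inj₁ (_ , M<rpt)) = inj₁ M<rpt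
    contained-right (yes tR) _ (inj₂ (inj₁ (e , _))) = ⊥-elim (proj₁ tR e)
    contained-right (yes tR) _ (inj₂ (inj₂ (_ , inj₁ (_ , e)))) = inj₁ (subst (_< rpt u) (sym e) u-nondeg)
    contained-right (yes tR) _ (inj₂ (inj₂ (_ , inj₂ (e₁ , e₂)))) = inj₂ (sym e₂ , tR , sym e₁)
    contained-right (no _) suc[M]≤ _ = inj₁ (ℤP.suc[i]≤j⇒i<j suc[M]≤)

    contains⇒meets-all : ∀ dL dR → Contains u (separatorFor dL dR) → ∀ {s} → s ∈ₗ ts → Meet u s
    contains⇒meets-all dL dR (≤l , r≤ , cL , cR) {s} s∈ts
      with lpt u ℤP.<? rpt s | lpt s ℤP.<? rpt u
    ... | yes h₁ | yes h₂ with ℤP.≤-total (lpt s) (lpt u)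
    ...   | inj₁ h = inj₁ (lpt u , ℤP.≤-refl , u-nondeg , h , h₁)
    ...   | inj₂ h = inj₁ (lpt s , h , h₂ , ℤP.≤-refl , nondegenerate s∈ts)
    contains⇒meets-all dL dR (≤l , r≤ , cL , cR) {s} s∈ts | no h₁ | _ with contained-left {dR} dL ≤l cL
    ... | inj₁ lpt<m = ⊥-elim (ℤP.≤⇒≯ (m≤rpt s∈ts) (ℤP.≤-<-trans (ℤP.≮⇒≥ h₁) lpt<m))
    ... | inj₂ (lpt≡m , (zL≢∅ , endsL) , e) =
      inj₂ (zL , m , zL≢∅ , inj₁ (sym e , sym lpt≡m) , inj₂ (sym (endsL s∈ts rpt≡m) , sym rpt≡m))
      where
      rpt≡m : rpt s ≡ m
      rpt≡m = ℤP.≤-antisym (subst (rpt s ≤_) lpt≡m (ℤP.≮⇒≥ h₁)) (m≤rpt s∈ts)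
    contains⇒meets-all dL dR (≤l , r≤ , cL , cR) {s} s∈ts | yes _ | no h₂ with contained-right {dL} dR r≤ cR
    ... | inj₁ M<rpt = ⊥-elim (ℤP.≤⇒≯ (lpt≤M s∈ts) (ℤP.<-≤-trans M<rpt (ℤP.≮⇒≥ h₂)))
    ... | inj₂ (rpt≡M , (zR≢∅ , endsR) , e) =
      inj₂ (zR , M , zR≢∅ , inj₂ (sym e , sym rpt≡M) , inj₁ (sym (endsR s∈ts lpt≡M) , sym lpt≡M))
      where
      lpt≡M : lpt s ≡ M
      lpt≡M = ℤP.≤-antisym (lpt≤M s∈ts) (subst (_≤ lpt s) rpt≡M (ℤP.≮⇒≥ h₂))

ContainsIffMeetsAll : List TInterval → TInterval → Set
ContainsIffMeetsAll ts t = ∀ u → lpt u < rpt u →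
  (Contains u t → ∀ {s} → s ∈ₗ ts → Meet u s) × ((∀ {s} → s ∈ₗ ts → Meet u s) → Contains u t)

separating-interval : ∀ d ts → (∀ {s} → s ∈ₗ ts → lpt s < rpt s) → (∀ {s} → s ∈ₗ ts → EndTypes d s) →
  ∀ {s₀ s₁} → s₀ ∈ₗ ts → s₁ ∈ₗ ts → ¬ Meet s₀ s₁ →
  ∃[ t ] (Proper t × (∀ {s} → s ∈ₗ ts → Intersects s t) × ContainsIffMeetsAll ts t)
separating-interval d ts nondegenerate typed s₀∈ts s₁∈ts ¬meet =
  separatorFor typedL? typedR? , separatorFor-proper typedL? typedR? , intersects-separatorFor typedL? typedR? ,
  λ u u-nondeg → contains⇒meets-all u u-nondeg typedL? typedR? ,
                 λ meets → meets-all⇒contains u u-nondeg meets typedL? typedR?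
  where open Separator d ts nondegenerate typed s₀∈ts s₁∈ts ¬meet

members : ∀ {n} (Y : Subset n) → List (∃ (_∈ Y))
members [] = []
members (true ∷ Y) = (Fin.zero , here) ∷ List.map (map× Fin.suc there) (members Y)
members (false ∷ Y) = List.map (map× Fin.suc there) (members Y)

∈-members : ∀ {n} {Y : Subset n} {y} (p : y ∈ Y) → (y , p) ∈ₗ members Y
∈-members {Y = true ∷ _} here = here refl
∈-members {Y = true ∷ _} (there p) = there (∈-map⁺ (map× Fin.suc there) (∈-members p))
∈-members {Y = false ∷ _} (there p) = ∈-map⁺ (map× Fin.suc there) (∈-members p)

indexIs2-row₁ : ∀ P {a b} → IndexIs2 P a b → IntersectsRow P a
indexIs2-row₁ P {a} index = proj₂ (index a) (inj₁ refl)

indexIs2-row₂ : ∀ P {a b} → IndexIs2 P a b → IntersectsRow P b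
indexIs2-row₂ P {b = b} index = proj₂ (index b) (inj₂ refl)

OtherIndex : ℤ → ℤ → GridPath → Set
OtherIndex a b P = IndexIs1 P a ⊎ ∃[ c ] (c ≢ a × c ≢ b × IndexIs2 P a c)

otherIndex-row : ∀ P {a b} → OtherIndex a b P → IntersectsRow P a
otherIndex-row P {a} (inj₁ index) = proj₂ (index a) refl
otherIndex-row P (inj₂ (_ , _ , _ , index)) = indexIs2-row₁ P index

otherIndex-avoids : ∀ P {a b} → a ≢ b → OtherIndex a b P → ∀ r → IntersectsRow P r → r ≢ b
otherIndex-avoids P a≢b (inj₁ index) r i refl = a≢b (sym (proj₁ (index r) i))
otherIndex-avoids P a≢b (inj₂ (c , _ , c≢b , index)) r i refl =
  [ a≢b ∘ sym , c≢b ∘ sym ] (proj₁ (index r) i)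

otherIndex-commonRow : ∀ P Q {a b} → a ≢ b → OtherIndex a b P → IndexIs2 Q a b →
                       ∀ r → IntersectsRow P r → IntersectsRow Q r → r ≡ a
otherIndex-commonRow P Q a≢b index indexQ r iP iQ =
  [ id , (λ r≡b → ⊥-elim (otherIndex-avoids P a≢b index r iP r≡b)) ] (proj₁ (indexQ r) iQ)

module Projections {n} (G : Graph n) (R : B2Rep G) {a b : ℤ} (a≢b : a ≢ b) (Y : Subset n)
         (indexY : ∀ y → y ∈ Y → IndexIs2 (path R y) a b) where

  viewY : ∀ {y} → y ∈ Y → RowView (path R y) a
  viewY {y} p = rowView (path R y) a (twoBends R y) (indexIs2-row₁ (path R y) (indexY y p))

  projections : List TInterval
  projections = List.map (λ (_ , p) → tproj (viewY p)) (members Y)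

  projection∈ : ∀ {y} (p : y ∈ Y) → tproj (viewY p) ∈ₗ projections
  projection∈ p = ∈-map⁺ (λ (_ , p) → tproj (viewY p)) (∈-members p)

  all-projections : {Q : TInterval → Set} → (∀ {y} (p : y ∈ Y) → Q (tproj (viewY p))) →
                    ∀ {s} → s ∈ₗ projections → Q s
  all-projections {Q} q s∈ with ∈-map⁻ (λ (_ , p) → tproj (viewY p)) s∈
  ... | (_ , p) , _ , refl = q p

  projection-endTypes : ∀ {y} (p : y ∈ Y) → EndTypes (direction a b) (tproj (viewY p))
  projection-endTypes {y} p with RowView.otherRow (viewY p) b (≢-sym a≢b) (indexIs2-row₂ (path R y) (indexY y p))
  ... | inj₁ (e₁ , e₂) = inj₁ e₁ , inj₂ e₂
  ... | inj₂ (e₁ , e₂) = inj₂ e₂ , inj₁ e₁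

  module _ {u} (index : OtherIndex a b (path R u)) where

    viewU : RowView (path R u) a
    viewU = rowView (path R u) a (twoBends R u) (otherIndex-row (path R u) index)

    u≢Y : ∀ {y} → y ∈ Y → u ≢ y
    u≢Y {y} p refl = otherIndex-avoids (path R u) a≢b index b (indexIs2-row₂ (path R y) (indexY y p)) refl

    adjacent⇔meet : ∀ {y} (p : y ∈ Y) → (Adj G u y → Meet (tproj viewU) (tproj (viewY p))) ×
                                         (Meet (tproj viewU) (tproj (viewY p)) → Adj G u y)
    adjacent⇔meet {y} p =
      shareEdge⇒meet viewU (viewY p) (otherIndex-commonRow (path R u) (path R y) a≢b index (indexY y p))
        ∘ proj₁ (adjIff R u y (u≢Y p)) ,
      proj₂ (adjIff R u y (u≢Y p)) ∘ meet⇒shareEdge viewU (viewY p)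

    pContains⇒contains : ∀ {t} → PContains (path R u) a t → Contains (tproj viewU) t
    pContains⇒contains {t} (_ , t′ , isProj , c) = subst (λ s → Contains s t) (tProj-unique viewU isProj) c

  separator : ∀ {u₀ v₀} → u₀ ∈ Y → v₀ ∈ Y → ¬ ProjAdj (path R u₀) (path R v₀) a →
              ∃[ t ] (Proper t × (∀ {s} → s ∈ₗ projections → Intersects s t) × ContainsIffMeetsAll projections t)
  separator u₀∈Y v₀∈Y ¬projAdj =
    separating-interval (direction a b) projections
      (all-projections (RowView.α<β ∘ viewY)) (all-projections projection-endTypes)
      (projection∈ u₀∈Y) (projection∈ v₀∈Y)
      (λ meet → ¬projAdj (_ , _ , tproj-isTProj (viewY u₀∈Y) , tproj-isTProj (viewY v₀∈Y) , meet⇒intersects meet))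

  Y-intersects : ∀ {t} → (∀ {s} → s ∈ₗ projections → Intersects s t) →
                 ∀ y → y ∈ Y → PIntersects (path R y) a t
  Y-intersects intersects y p = indexIs2-row₁ (path R y) (indexY y p) , _ , tproj-isTProj (viewY p) ,
                                intersects (projection∈ p)

  module _ {t u} (containsIffMeets : ContainsIffMeetsAll projections t) (index : OtherIndex a b (path R u)) where

    adjacent-all⇒contains : (∀ y → y ∈ Y → Adj G u y) → PContains (path R u) a t
    adjacent-all⇒contains adj =
      otherIndex-row (path R u) index , _ , tproj-isTProj (viewU index) ,
      proj₂ (containsIffMeets _ (RowView.α<β (viewU index)))
        (all-projections (λ p → proj₁ (adjacent⇔meet index p) (adj _ p)))

    contains⇒adjacent-all : PContains (path R u) a t → ∀ y → y ∈ Y → Adj G u y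
    contains⇒adjacent-all c y p =
      proj₂ (adjacent⇔meet index p)
        (proj₁ (containsIffMeets _ (RowView.α<β (viewU index))) (pContains⇒contains index c) (projection∈ p))

mainTheorem7 : {n : ℕ} (G : Graph n) (R : B2Rep G) (a b : ℤ) → a ≢ b →
    (Y : Subset n) →
    (∀ y → y ∈ Y → IndexIs2 (path R y) a b) →
    (∃[ u ] ∃[ v ] (u ∈ Y × v ∈ Y × u ≢ v × ¬ ProjAdj (path R u) (path R v) a)) →
    ∃[ t ] (Proper t ×
      (∀ y → y ∈ Y → PIntersects (path R y) a t) ×
      (∀ u → (IndexIs1 (path R u) a ⊎
              ∃[ c ] (c ≢ a × c ≢ b × IndexIs2 (path R u) a c)) →
        ((∀ y → y ∈ Y → Adj G u y) → PContains (path R u) a t) ×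
        (PContains (path R u) a t → ∀ y → y ∈ Y → Adj G u y)))
mainTheorem7 G R a b a≢b Y indexY (_ , _ , u₀∈Y , v₀∈Y , _ , ¬projAdj)
  with Projections.separator G R a≢b Y indexY u₀∈Y v₀∈Y ¬projAdj
... | t , proper , intersects , containsIffMeets =
  t , proper , Y-intersects intersects ,
  λ u index → adjacent-all⇒contains containsIffMeets index , contains⇒adjacent-all containsIffMeets index
  where open Projections G R a≢b Y indexY
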